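{- If $k\ge 3$ and $n\ge k+3$, then there exists a generic arrangement $\mathcal A^0$ of $n$ hyperplanes in $\mathbb C^k$ such that the corresponding discriminantal arrangement $\mathcal B(n,k,\mathcal A_\infty)$ has a codimension two stratum of multiplicity $3$.
   Context: An arrangement of affine hyperplanes $H^0_i=\{y\in\mathbb C^k:\alpha^i\cdot y=c_i\}$, $i=1,\dots,n$, is generic if any $k$ of the normal vectors $\alpha^i$ are linearly independent, i.e. its trace at infinity $\mathcal A_\infty=\{\overline{H^0_i}\cap H_\infty\}$ is a generic arrangement in $H_\infty\cong\mathbb P^{k-1}$. The space of parallel translates is $\mathbb C^n$, $x\mapsto\{H_i(x)=\{\alpha^i\cdot y=x_i\}\}$. For $|K|=k+1$, $D_K=\{x:\bigcap_{i\in K}H_i(x)\ne\emptyset\}$ is a hyperplane, and $\mathcal B(n,k,\mathcal A_\infty)$ is the arrangement of all $D_K$. A codimension two stratum of multiplicity $m$ is a codimension $2$ subspace of $\mathbb C^n$ which is an intersection of hyperplanes $D_K$ and is contained in exactly $m$ of them. -}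

module Defs where

open import Level using (Level; _⊔_) renaming (suc to lsuc)
open import Data.Nat using (ℕ; zero; suc)
open import Data.Fin using (Fin; zero; suc)
open import Data.Fin.Subset using (Subset; _∈_; ∣_∣)
open import Data.List using (List; []; _∷_)
open import Data.List.Relation.Unary.All using (All)
open import Data.Product using (_×_; ∃; Σ)
open import Data.Sum using (_⊎_)
open import Relation.Nullary using (¬_)
open import Relation.Binary.PropositionalEquality using (_≡_)
open import Algebra.Bundles using (CommutativeRing)

-- Fields (the standard library has no Field bundle)

record Field (c ℓ : Level) : Set (lsuc (c ⊔ ℓ)) where
  field
    commutativeRing : CommutativeRing c ℓ
  open CommutativeRing commutativeRing public
  field
    1≉0     : ¬ (1# ≈ 0#)
    inverse : ∀ x → ¬ (x ≈ 0#) → ∃ λ y → (x * y) ≈ 1#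

module FieldNotions {c ℓ : Level} (F : Field c ℓ) where
  open Field F using (Carrier; _≈_; _+_; _*_; 0#; 1#)

  ℕ→F : ℕ → Carrier
  ℕ→F zero    = 0#
  ℕ→F (suc m) = 1# + ℕ→F m

  HasCharZero : Set ℓ
  HasCharZero = ∀ m → ¬ (ℕ→F (suc m) ≈ 0#)

  -- evalMonic [a₀,…,a_{d-1}] x = a₀ + a₁x + … + a_{d-1}x^{d-1} + x^d
  evalMonic : List Carrier → Carrier → Carrier
  evalMonic []       x = 1#
  evalMonic (a ∷ as) x = a + (x * evalMonic as x)

  IsAlgClosed : Set (c ⊔ ℓ)
  IsAlgClosed = ∀ (a : Carrier) (as : List Carrier) → ∃ λ x → evalMonic (a ∷ as) x ≈ 0#

  Σᶠ : ∀ {m} → (Fin m → Carrier) → Carrier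
  Σᶠ {zero}  f = 0#
  Σᶠ {suc m} f = f zero + Σᶠ (λ j → f (suc j))

  _·_ : ∀ {m} → (Fin m → Carrier) → (Fin m → Carrier) → Carrier
  u · v = Σᶠ (λ j → u j * v j)

  -- Affine arrangements A⁰ = {α^i · y = c_i} in F^k, i = 1..n.
  -- α i is the normal vector α^i, c i the constant c_i.

  IsGeneric : ∀ {n k} → (Fin n → Fin k → Carrier) → Set (c ⊔ ℓ)
  IsGeneric {n} {k} α =
    ∀ (s : Fin k → Fin n) → (∀ i j → s i ≡ s j → i ≡ j) →
    ∀ (λs : Fin k → Carrier) →
      (∀ t → Σᶠ (λ j → λs j * α (s j) t) ≈ 0#) → ∀ j → λs j ≈ 0#

  -- D_K ⊆ F^n (space of parallel translates), for K ⊆ {1..n}: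
  -- x ∈ D_K iff the translated hyperplanes H_i(x) = {α^i · y = x_i}, i ∈ K,
  -- have a common point.
  D : ∀ {n k} → (Fin n → Fin k → Carrier) → Subset n → (Fin n → Carrier) → Set (c ⊔ ℓ)
  D {n} {k} α K x = ∃ λ (y : Fin k → Carrier) → ∀ i → i ∈ K → (α i · y) ≈ x i

  -- the hyperplanes of B(n,k,A∞) are the D_K with |K| = k+1
  IsIndex : ∀ {n} → ℕ → Subset n → Set
  IsIndex k K = ∣ K ∣ ≡ suc k

  _⊆ₚ_ : ∀ {n} → ((Fin n → Carrier) → Set (c ⊔ ℓ)) → ((Fin n → Carrier) → Set (c ⊔ ℓ)) → Set (c ⊔ ℓ)
  P ⊆ₚ Q = ∀ x → P x → Q x

  _≐_ : ∀ {n} → ((Fin n → Carrier) → Set (c ⊔ ℓ)) → ((Fin n → Carrier) → Set (c ⊔ ℓ)) → Set (c ⊔ ℓ)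
  P ≐ Q = (P ⊆ₚ Q) × (Q ⊆ₚ P)

  IsCodim2Subspace : ∀ {n} → ((Fin n → Carrier) → Set (c ⊔ ℓ)) → Set (c ⊔ ℓ)
  IsCodim2Subspace {n} X =
    ∃ λ (f : Fin n → Carrier) → ∃ λ (g : Fin n → Carrier) →
      (∀ a b → (∀ i → ((a * f i) + (b * g i)) ≈ 0#) → (a ≈ 0#) × (b ≈ 0#)) ×
      (∀ x → (X x → ((f · x) ≈ 0#) × ((g · x) ≈ 0#)) ×
             (((f · x) ≈ 0#) × ((g · x) ≈ 0#) → X x))

  IsIntersectionOfD : ∀ {n k} → (Fin n → Fin k → Carrier) → ((Fin n → Carrier) → Set (c ⊔ ℓ)) → Set (c ⊔ ℓ)
  IsIntersectionOfD {n} {k} α X =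
    ∃ λ (S : List (Subset n)) → All (IsIndex k) S ×
      (X ≐ (λ x → All (λ K → D α K x) S))

  ContainedInExactly3 : ∀ {n k} → (Fin n → Fin k → Carrier) → ((Fin n → Carrier) → Set (c ⊔ ℓ)) → Set (c ⊔ ℓ)
  ContainedInExactly3 {n} {k} α X =
    ∃ λ K₁ → ∃ λ K₂ → ∃ λ K₃ →
      IsIndex k K₁ × IsIndex k K₂ × IsIndex k K₃ ×
      (X ⊆ₚ D α K₁) × (X ⊆ₚ D α K₂) × (X ⊆ₚ D α K₃) ×
      ¬ (D α K₁ ≐ D α K₂) × ¬ (D α K₁ ≐ D α K₃) × ¬ (D α K₂ ≐ D α K₃) ×
      (∀ K → IsIndex k K → X ⊆ₚ D α K →
         (D α K ≐ D α K₁) ⊎ (D α K ≐ D α K₂) ⊎ (D α K ≐ D α K₃))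

  HasCodim2StratumMult3 : ∀ {n k} → (Fin n → Fin k → Carrier) → Set (lsuc (c ⊔ ℓ))
  HasCodim2StratumMult3 {n} {k} α =
    ∃ λ (X : (Fin n → Carrier) → Set (c ⊔ ℓ)) →
      IsCodim2Subspace X × IsIntersectionOfD α X × ContainedInExactly3 α X

{-# OPTIONS --safe #-}
-- Put the normal vectors on the moment curve, α^i = (1, t_i, …, t_i^{k-1}) with distinct t_i.
-- Then α^i · y is the value at t_i of the polynomial of degree < k with coefficients y, so any
-- k of the α^i are independent (Vandermonde), and x ∈ D_K means that a polynomial of degree
-- < k interpolates x_i at t_i for i ∈ K. Choose k + 3 nodes U consisting of three pairs with a
-- common sum σ and k − 3 further nodes, and let K_i be U without the i-th pair. As
-- (x − a)(x − b) − (x − c)(x − d) is constant when a + b = c + d, the nodal polynomials of two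
-- pairs have the same ratio at the two points of the third pair; this lets one glue
-- interpolants on K₂ and K₃ into one on K₁, so X = D_{K₂} ∩ D_{K₃} ⊆ D_{K₁}. Conversely, if
-- X ⊆ D_K then unit vectors force K ⊆ U, and the point g_u = ∏_{v ∈ K₁} (t_u − t_v) of X shows
-- that U ∖ K is a pair with sum σ; for the nodes 4,10 | 6,8 | 5,9 | 11,12,… that is one of the
-- three pairs, so X lies on exactly D_{K₁}, D_{K₂}, D_{K₃}.
module Submission where

open import Level using (Level; _⊔_)
open import Data.Bool using (Bool; true; false)
open import Data.Empty using (⊥-elim)
open import Data.Fin using (Fin; zero; suc; toℕ; punchIn)
open import Data.Fin.Patterns using (0F; 1F; 2F; 3F; 4F; 5F)
import Data.Fin.Properties as Finₚ
open import Function using (_∘_; _∘′_; const)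
open import Function.Definitions using (Injective)
open import Data.Fin.Subset using (Subset; _∈_; _∉_; ∣_∣; _⊆_; _∩_; _∪_; _─_; _-_; ⁅_⁆; ⊤; inside; outside)
import Data.Fin.Subset.Properties as Subsetₚ
open import Data.List using (List; []; _∷_; length)
open import Data.List.Relation.Unary.All using ([]; _∷_)
open import Data.Nat as ℕ using (ℕ; zero; suc; z≤n; s≤s)
import Data.Nat.Properties as ℕₚ
open import Data.Maybe using (Maybe; just; nothing)
import Data.Integer as ℤ
open ℤ using (ℤ)
import Data.Integer.Properties as ℤₚ
import Data.Sign as Sign
open Sign using (Sign)
open import Data.Product using (_×_; _,_; proj₁; proj₂; ∃; ∃₂)
open import Data.Sum as Sum using (_⊎_; inj₁; inj₂)
open import Data.Vec using ([]; _∷_; here; there; replicate; _++_)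
open import Relation.Nullary using (¬_; Dec; yes; no)
open import Relation.Binary.PropositionalEquality as ≡ using (_≡_; _≢_)

open import Defs

here⁺ : ∀ {n b} {p : Subset n} → b ≡ true → zero ∈ b ∷ p
here⁺ ≡.refl = here

x∈p─q⇒x∉q : ∀ {n} {x : Fin n} (p q : Subset n) → x ∈ p ─ q → x ∉ q
x∈p─q⇒x∉q (inside ∷ p) (outside ∷ q) here ()
x∈p─q⇒x∉q (_ ∷ p) (_ ∷ q) (there x∈p─q) (there x∈q) = x∈p─q⇒x∉q p q x∈p─q x∈q

x∈p-y⇒x≢y : ∀ {n} {x : Fin n} (p : Subset n) y → x ∈ p - y → x ≢ y
x∈p-y⇒x≢y p y x∈p-y ≡.refl = x∈p─q⇒x∉q p ⁅ y ⁆ x∈p-y (Subsetₚ.x∈⁅x⁆ y)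

x∈p-y⇒x∈p : ∀ {n} {x : Fin n} (p : Subset n) y → x ∈ p - y → x ∈ p
x∈p-y⇒x∈p p y = Subsetₚ.p─q⊆p p ⁅ y ⁆

∣p-x∣ : ∀ {n} {x : Fin n} (p : Subset n) → x ∈ p → suc ∣ p - x ∣ ≡ ∣ p ∣
∣p-x∣ {x = zero}  (inside ∷ p)  here        = ≡.cong (λ q → suc ∣ q ∣) (Subsetₚ.p─⊥≡p p)
∣p-x∣ {x = suc x} (inside ∷ p)  (there x∈p) = ≡.cong suc (∣p-x∣ p x∈p)
∣p-x∣ {x = suc x} (outside ∷ p) (there x∈p) = ∣p-x∣ p x∈p

∣p-x∣≡m : ∀ {n m} {x : Fin n} (p : Subset n) → x ∈ p → ∣ p ∣ ≡ suc m → ∣ p - x ∣ ≡ m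
∣p-x∣≡m p x∈p ∣p∣≡1+m = ℕₚ.suc-injective (≡.trans (∣p-x∣ p x∈p) ∣p∣≡1+m)

∣p∣≡∣p∩q∣+∣p─q∣ : ∀ {n} (p q : Subset n) → ∣ p ∣ ≡ ∣ p ∩ q ∣ ℕ.+ ∣ p ─ q ∣
∣p∣≡∣p∩q∣+∣p─q∣ []            []            = ≡.refl
∣p∣≡∣p∩q∣+∣p─q∣ (inside ∷ p)  (inside ∷ q)  = ≡.cong suc (∣p∣≡∣p∩q∣+∣p─q∣ p q)
∣p∣≡∣p∩q∣+∣p─q∣ (inside ∷ p)  (outside ∷ q) =
  ≡.trans (≡.cong suc (∣p∣≡∣p∩q∣+∣p─q∣ p q)) (≡.sym (ℕₚ.+-suc _ _))
∣p∣≡∣p∩q∣+∣p─q∣ (outside ∷ p) (inside ∷ q)  = ∣p∣≡∣p∩q∣+∣p─q∣ p q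
∣p∣≡∣p∩q∣+∣p─q∣ (outside ∷ p) (outside ∷ q) = ∣p∣≡∣p∩q∣+∣p─q∣ p q

p⊆q∧∣q∣≤∣p∣⇒p≡q : ∀ {n} {p q : Subset n} → p ⊆ q → ∣ q ∣ ℕ.≤ ∣ p ∣ → p ≡ q
p⊆q∧∣q∣≤∣p∣⇒p≡q {p = p} p⊆q ∣q∣≤∣p∣ = Subsetₚ.⊆-antisym p⊆q q⊆p
  where
  q⊆p : _ ⊆ p
  q⊆p {x} x∈q with x Subsetₚ.∈? p
  ... | yes x∈p = x∈p
  ... | no  x∉p = ⊥-elim (ℕₚ.<⇒≱ (Subsetₚ.p⊂q⇒∣p∣<∣q∣ (p⊆q , x , x∈q , x∉p)) ∣q∣≤∣p∣)

∣p∣≡1+m⇒nonempty : ∀ {n m} (p : Subset n) → ∣ p ∣ ≡ suc m → ∃ λ x → x ∈ p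
∣p∣≡1+m⇒nonempty (inside ∷ p)  _ = zero , here
∣p∣≡1+m⇒nonempty (outside ∷ p) e = let x , x∈p = ∣p∣≡1+m⇒nonempty p e in suc x , there x∈p

module _ {c ℓ} (F : Field c ℓ) where
  open Field F hiding (zero; _-_)
  open FieldNotions F
  open import Relation.Binary.Reasoning.Setoid setoid
  open import Algebra.Bundles using (Semiring)
  open import Algebra.Solver.Ring.AlmostCommutativeRing using (fromCommutativeRing; _-Raw-AlmostCommutative⟶_)
  open import Algebra.Properties.CommutativeSemigroup +-commutativeSemigroup using () renaming (interchange to +-interchange)
  open import Algebra.Properties.CommutativeSemigroup *-commutativeSemigroup using () renaming (interchange to *-interchange; x∙yz≈y∙xz to x*yz≈y*xz)
  open import Algebra.Properties.Group +-group using (x∙y⁻¹≈ε⇒x≈y; x≈y⇒x∙y⁻¹≈ε; ∙-cancelˡ; ε⁻¹≈ε; ⁻¹-involutive)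
  open import Algebra.Properties.AbelianGroup +-abelianGroup using (⁻¹-anti-homo-∙)
  open import Algebra.Properties.Ring ring using (-1*x≈-x; -‿distribʳ-*)
  open import Algebra.Definitions.RawSemiring (Semiring.rawSemiring semiring) using (_^_)
  open import Algebra.Properties.Semiring.Sum semiring
    using (sum; sum-cong-≋; ∑-distrib-+; ∑-comm; *-distribˡ-sum; *-distribʳ-sum; sum-remove; sum-replicate-zero)

  infixl 6 _−_
  _−_ : Carrier → Carrier → Carrier
  x − y = x + - y

  x−y≈0⇒x≈y : ∀ {x y} → x − y ≈ 0# → x ≈ y
  x−y≈0⇒x≈y = x∙y⁻¹≈ε⇒x≈y _ _

  x≈y⇒x−y≈0 : ∀ {x y} → x ≈ y → x − y ≈ 0#
  x≈y⇒x−y≈0 = x≈y⇒x∙y⁻¹≈ε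

  x≉y⇒x−y≉0 : ∀ {x y} → x ≉ y → x − y ≉ 0#
  x≉y⇒x−y≉0 x≉y = x≉y ∘′ x−y≈0⇒x≈y

  x≈0⇒y*x≈0 : ∀ {x} y → x ≈ 0# → y * x ≈ 0#
  x≈0⇒y*x≈0 y x≈0 = trans (*-congˡ x≈0) (zeroʳ y)

  inv : ∀ x → x ≉ 0# → Carrier
  inv x x≉0 = proj₁ (inverse x x≉0)

  *-inverseʳ : ∀ x (x≉0 : x ≉ 0#) → x * inv x x≉0 ≈ 1#
  *-inverseʳ x x≉0 = proj₂ (inverse x x≉0)

  *-inverseˡ : ∀ x (x≉0 : x ≉ 0#) → inv x x≉0 * x ≈ 1#
  *-inverseˡ x x≉0 = trans (*-comm _ x) (*-inverseʳ x x≉0)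

  *-cancelˡ : ∀ {x y z} → x ≉ 0# → x * y ≈ x * z → y ≈ z
  *-cancelˡ {x} {y} {z} x≉0 xy≈xz = begin
    y                   ≈⟨ unfold y ⟩
    inv x x≉0 * (x * y) ≈⟨ *-congˡ xy≈xz ⟩
    inv x x≉0 * (x * z) ≈⟨ unfold z ⟨
    z                   ∎
    where
    unfold : ∀ w → w ≈ inv x x≉0 * (x * w)
    unfold w = begin
      w                   ≈⟨ *-identityˡ w ⟨
      1# * w              ≈⟨ *-congʳ (*-inverseˡ x x≉0) ⟨
      inv x x≉0 * x * w   ≈⟨ *-assoc _ x w ⟩
      inv x x≉0 * (x * w) ∎

  x*y≈0⇒y≈0 : ∀ {x y} → x ≉ 0# → x * y ≈ 0# → y ≈ 0#
  x*y≈0⇒y≈0 {x} x≉0 xy≈0 = *-cancelˡ x≉0 (trans xy≈0 (sym (zeroʳ x)))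

  x≉0∧y≉0⇒x*y≉0 : ∀ {x y} → x ≉ 0# → y ≉ 0# → x * y ≉ 0#
  x≉0∧y≉0⇒x*y≉0 x≉0 y≉0 = y≉0 ∘′ x*y≈0⇒y≈0 x≉0

  ℕ→F-+ : ∀ a b → ℕ→F (a ℕ.+ b) ≈ ℕ→F a + ℕ→F b
  ℕ→F-+ zero    b = sym (+-identityˡ _)
  ℕ→F-+ (suc a) b = trans (+-congˡ (ℕ→F-+ a b)) (sym (+-assoc 1# _ _))

  ℕ→F-injective : HasCharZero → ∀ {a b} → ℕ→F a ≈ ℕ→F b → a ≡ b
  ℕ→F-injective char0 {zero}  {zero}  _ = ≡.refl
  ℕ→F-injective char0 {zero}  {suc b} e = ⊥-elim (char0 b (sym e))
  ℕ→F-injective char0 {suc a} {zero}  e = ⊥-elim (char0 a e)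
  ℕ→F-injective char0 {suc a} {suc b} e = ≡.cong suc (ℕ→F-injective char0 (∙-cancelˡ 1# _ _ e))

  ℕ→F-* : ∀ a b → ℕ→F (a ℕ.* b) ≈ ℕ→F a * ℕ→F b
  ℕ→F-* zero    b = sym (zeroˡ _)
  ℕ→F-* (suc a) b = begin
    ℕ→F (b ℕ.+ a ℕ.* b)        ≈⟨ ℕ→F-+ b (a ℕ.* b) ⟩
    ℕ→F b + ℕ→F (a ℕ.* b)      ≈⟨ +-cong (*-identityˡ _) (sym (ℕ→F-* a b)) ⟨
    1# * ℕ→F b + ℕ→F a * ℕ→F b ≈⟨ distribʳ _ 1# _ ⟨
    (1# + ℕ→F a) * ℕ→F b       ∎

  -- Integer coefficients give the ring solver a decidable zero test, which it needs to cancel x − x.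
  ℤ→F : ℤ → Carrier
  ℤ→F (ℤ.+ n)    = ℕ→F n
  ℤ→F ℤ.-[1+ n ] = - ℕ→F (suc n)

  -0≈0 : - 0# ≈ 0#
  -0≈0 = ε⁻¹≈ε

  ℤ→F-⊖ : ∀ m n → ℤ→F (m ℤ.⊖ n) ≈ ℕ→F m − ℕ→F n
  ℤ→F-⊖ zero    zero    = sym (-‿inverseʳ 0#)
  ℤ→F-⊖ zero    (suc n) = sym (+-identityˡ _)
  ℤ→F-⊖ (suc m) zero    = sym (trans (+-congˡ -0≈0) (+-identityʳ _))
  ℤ→F-⊖ (suc m) (suc n) = begin
    ℤ→F (suc m ℤ.⊖ suc n)                  ≡⟨ ≡.cong ℤ→F (ℤₚ.[1+m]⊖[1+n]≡m⊖n m n) ⟩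
    ℤ→F (m ℤ.⊖ n)                          ≈⟨ ℤ→F-⊖ m n ⟩
    ℕ→F m − ℕ→F n                          ≈⟨ +-identityʳ _ ⟨
    ℕ→F m − ℕ→F n + 0#                     ≈⟨ +-congˡ (-‿inverseʳ 1#) ⟨
    ℕ→F m − ℕ→F n + (1# − 1#)              ≈⟨ +-interchange _ _ _ _ ⟩
    (ℕ→F m + 1#) + (- ℕ→F n + - 1#)        ≈⟨ +-congʳ (+-comm _ 1#) ⟩
    (1# + ℕ→F m) + (- ℕ→F n + - 1#)        ≈⟨ +-congˡ (⁻¹-anti-homo-∙ 1# (ℕ→F n)) ⟨
    (1# + ℕ→F m) − (1# + ℕ→F n)            ∎

  ℤ→F-+ : ∀ i j → ℤ→F (i ℤ.+ j) ≈ ℤ→F i + ℤ→F j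
  ℤ→F-+ ℤ.-[1+ m ] ℤ.-[1+ n ] = begin
    - ℕ→F (suc (suc (m ℕ.+ n)))      ≡⟨ ≡.cong (λ a → - ℕ→F (suc a)) (ℕₚ.+-suc m n) ⟨
    - ℕ→F (suc m ℕ.+ suc n)          ≈⟨ -‿cong (ℕ→F-+ (suc m) (suc n)) ⟩
    - (ℕ→F (suc m) + ℕ→F (suc n))    ≈⟨ ⁻¹-anti-homo-∙ _ _ ⟩
    - ℕ→F (suc n) + - ℕ→F (suc m)    ≈⟨ +-comm _ _ ⟩
    - ℕ→F (suc m) + - ℕ→F (suc n)    ∎
  ℤ→F-+ ℤ.-[1+ m ] (ℤ.+ n)    = trans (ℤ→F-⊖ n (suc m)) (+-comm _ _)
  ℤ→F-+ (ℤ.+ m)    ℤ.-[1+ n ] = ℤ→F-⊖ m (suc n)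
  ℤ→F-+ (ℤ.+ m)    (ℤ.+ n)    = ℕ→F-+ m n

  ℤ→F-neg : ∀ i → ℤ→F (ℤ.- i) ≈ - ℤ→F i
  ℤ→F-neg ℤ.-[1+ n ]     = sym (⁻¹-involutive _)
  ℤ→F-neg (ℤ.+ zero)    = sym -0≈0
  ℤ→F-neg (ℤ.+ (suc n)) = refl

  signF : Sign → Carrier
  signF Sign.+ = 1#
  signF Sign.- = - 1#

  signF-* : ∀ s s′ → signF (s Sign.* s′) ≈ signF s * signF s′
  signF-* Sign.+ s′     = sym (*-identityˡ _)
  signF-* Sign.- Sign.+ = sym (*-identityʳ _)
  signF-* Sign.- Sign.- = sym (trans (-1*x≈-x _) (⁻¹-involutive _))

  ℤ→F-◃ : ∀ s n → ℤ→F (s ℤ.◃ n) ≈ signF s * ℕ→F n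
  ℤ→F-◃ s      zero    = sym (zeroʳ _)
  ℤ→F-◃ Sign.+ (suc n) = sym (*-identityˡ _)
  ℤ→F-◃ Sign.- (suc n) = sym (-1*x≈-x _)

  ℤ→F-* : ∀ i j → ℤ→F (i ℤ.* j) ≈ ℤ→F i * ℤ→F j
  ℤ→F-* i j = begin
    ℤ→F (i ℤ.* j)
      ≈⟨ ℤ→F-◃ (ℤ.sign i Sign.* ℤ.sign j) (ℤ.∣ i ∣ ℕ.* ℤ.∣ j ∣) ⟩
    signF (ℤ.sign i Sign.* ℤ.sign j) * ℕ→F (ℤ.∣ i ∣ ℕ.* ℤ.∣ j ∣)
      ≈⟨ *-cong (signF-* (ℤ.sign i) (ℤ.sign j)) (ℕ→F-* ℤ.∣ i ∣ ℤ.∣ j ∣) ⟩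
    (signF (ℤ.sign i) * signF (ℤ.sign j)) * (ℕ→F ℤ.∣ i ∣ * ℕ→F ℤ.∣ j ∣)
      ≈⟨ *-interchange _ _ _ _ ⟩
    (signF (ℤ.sign i) * ℕ→F ℤ.∣ i ∣) * (signF (ℤ.sign j) * ℕ→F ℤ.∣ j ∣)
      ≈⟨ *-cong (signed i) (signed j) ⟩
    ℤ→F i * ℤ→F j ∎
    where
    signed : ∀ i → signF (ℤ.sign i) * ℕ→F ℤ.∣ i ∣ ≈ ℤ→F i
    signed i = trans (sym (ℤ→F-◃ (ℤ.sign i) ℤ.∣ i ∣)) (reflexive (≡.cong ℤ→F (ℤₚ.◃-inverse i)))

  ℤ→F-homomorphism : ℤ.+-*-rawRing -Raw-AlmostCommutative⟶ fromCommutativeRing commutativeRing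
  ℤ→F-homomorphism = record
    { ⟦_⟧ = ℤ→F ; +-homo = ℤ→F-+ ; *-homo = ℤ→F-* ; -‿homo = ℤ→F-neg
    ; 0-homo = refl ; 1-homo = +-identityʳ 1# }

  ℤ→F-≟ : ∀ i j → Maybe (ℤ→F i ≈ ℤ→F j)
  ℤ→F-≟ i j with i ℤ.≟ j
  ... | yes i≡j = just (reflexive (≡.cong ℤ→F i≡j))
  ... | no  _   = nothing

  open import Algebra.Solver.Ring ℤ.+-*-rawRing (fromCommutativeRing commutativeRing) ℤ→F-homomorphism ℤ→F-≟
    using (solve; _:=_; _:+_; _:*_; :-_; _:-_)

  a*b*c⁻¹*d≈a*e : ∀ a {b c d e} (c≉0 : c ≉ 0#) → b * d ≈ e * c → a * b * inv c c≉0 * d ≈ a * e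
  a*b*c⁻¹*d≈a*e a {b} {c} {d} {e} c≉0 bd≈ec = begin
    a * b * inv c c≉0 * d   ≈⟨ solve 4 (λ a b i d → a :* b :* i :* d := a :* (b :* d :* i)) refl a b _ d ⟩
    a * (b * d * inv c c≉0) ≈⟨ *-congˡ (*-congʳ bd≈ec) ⟩
    a * (e * c * inv c c≉0) ≈⟨ *-congˡ (trans (*-assoc e c _) (trans (*-congˡ (*-inverseʳ c c≉0)) (*-identityʳ e))) ⟩
    a * e                   ∎

  [z−a][z−b]−[w−a][w−b] : ∀ a b z w → (z − a) * (z − b) − (w − a) * (w − b) ≈ (z − w) * ((z + w) − (a + b))
  [z−a][z−b]−[w−a][w−b] = solve 4 (λ a b z w →
    (z :- a) :* (z :- b) :- (w :- a) :* (w :- b) := (z :- w) :* ((z :+ w) :- (a :+ b))) refl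

  a+b≈z+w⇒[z−a][z−b]≈[w−a][w−b] : ∀ {a b z w} → a + b ≈ z + w → (z − a) * (z − b) ≈ (w − a) * (w − b)
  a+b≈z+w⇒[z−a][z−b]≈[w−a][w−b] {a} {b} {z} {w} a+b≈z+w = x−y≈0⇒x≈y (begin
    (z − a) * (z − b) − (w − a) * (w − b) ≈⟨ [z−a][z−b]−[w−a][w−b] a b z w ⟩
    (z − w) * ((z + w) − (a + b))         ≈⟨ x≈0⇒y*x≈0 (z − w) (x≈y⇒x−y≈0 (sym a+b≈z+w)) ⟩
    0#                                    ∎)

  [z−a][z−b]≈[w−a][w−b]⇒a+b≈z+w : ∀ {a b z w} → z ≉ w → (z − a) * (z − b) ≈ (w − a) * (w − b) → a + b ≈ z + w
  [z−a][z−b]≈[w−a][w−b]⇒a+b≈z+w {a} {b} {z} {w} z≉w eq = sym (x−y≈0⇒x≈y (x*y≈0⇒y≈0 (x≉y⇒x−y≉0 z≉w) (begin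
    (z − w) * ((z + w) − (a + b))         ≈⟨ [z−a][z−b]−[w−a][w−b] a b z w ⟨
    (z − a) * (z − b) − (w − a) * (w − b) ≈⟨ x≈y⇒x−y≈0 eq ⟩
    0#                                    ∎)))

  Σᶠ≡sum : ∀ {m} (f : Fin m → Carrier) → Σᶠ f ≡ sum f
  Σᶠ≡sum {zero}  f = ≡.refl
  Σᶠ≡sum {suc m} f = ≡.cong (f zero +_) (Σᶠ≡sum (f ∘ suc))

  sum-neg : ∀ {m} (f : Fin m → Carrier) → sum (λ j → - f j) ≈ - sum f
  sum-neg f = begin
    sum (λ j → - f j)     ≈⟨ sum-cong-≋ (λ j → -1*x≈-x (f j)) ⟨
    sum (λ j → - 1# * f j) ≈⟨ *-distribˡ-sum (- 1#) f ⟨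
    - 1# * sum f           ≈⟨ -1*x≈-x (sum f) ⟩
    - sum f                ∎

  sum-single : ∀ {m} (f : Fin m → Carrier) i → (∀ j → j ≢ i → f j ≈ 0#) → sum f ≈ f i
  sum-single {suc m} f i f≈0 = begin
    sum f                      ≈⟨ sum-remove f ⟩
    f i + sum (f ∘ punchIn i) ≈⟨ +-congˡ (sum-cong-≋ (λ j → f≈0 _ (Finₚ.punchInᵢ≢i i j))) ⟩
    f i + sum {m} (λ _ → 0#)   ≈⟨ +-congˡ (sum-replicate-zero m) ⟩
    f i + 0#                   ≈⟨ +-identityʳ (f i) ⟩
    f i                        ∎

  -- Polynomials of degree < k as coefficient vectors

  eval : ∀ {k} → (Fin k → Carrier) → Carrier → Carrier
  eval y x = sum (λ j → x ^ toℕ j * y j)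

  eval-suc : ∀ {k} (y : Fin (suc k) → Carrier) x → eval y x ≈ y zero + x * eval (y ∘ suc) x
  eval-suc {k} y x = +-cong (*-identityˡ (y zero)) (begin
    sum (λ j → x * x ^ toℕ j * y (suc j))   ≈⟨ sum-cong-≋ {k} (λ j → *-assoc x _ _) ⟩
    sum (λ j → x * (x ^ toℕ j * y (suc j))) ≈⟨ *-distribˡ-sum {k} x _ ⟨
    x * eval (y ∘ suc) x                    ∎)

  eval-+ : ∀ {k} (y z : Fin k → Carrier) x → eval (λ j → y j + z j) x ≈ eval y x + eval z x
  eval-+ {k} y z x = trans (sum-cong-≋ {k} (λ j → distribˡ _ (y j) (z j))) (∑-distrib-+ {k} _ _)

  eval-* : ∀ {k} a (y : Fin k → Carrier) x → eval (λ j → a * y j) x ≈ a * eval y x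
  eval-* {k} a y x = begin
    sum (λ j → x ^ toℕ j * (a * y j)) ≈⟨ sum-cong-≋ {k} (λ j → x*[a*y]≈a*[x*y] _ a (y j)) ⟩
    sum (λ j → a * (x ^ toℕ j * y j)) ≈⟨ *-distribˡ-sum {k} a _ ⟨
    a * eval y x                      ∎
    where
    x*[a*y]≈a*[x*y] : ∀ x a y → x * (a * y) ≈ a * (x * y)
    x*[a*y]≈a*[x*y] = solve 3 (λ x a y → x :* (a :* y) := a :* (x :* y)) refl

  eval-− : ∀ {k} (y z : Fin k → Carrier) x → eval (λ j → y j − z j) x ≈ eval y x − eval z x
  eval-− {k} y z x = begin
    eval (λ j → y j − z j) x                   ≈⟨ eval-+ y (λ j → - z j) x ⟩
    eval y x + sum (λ j → x ^ toℕ j * - z j)   ≈⟨ +-congˡ (sum-cong-≋ {k} (λ j → -‿distribʳ-* _ (z j))) ⟨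
    eval y x + sum (λ j → - (x ^ toℕ j * z j)) ≈⟨ +-congˡ (sum-neg {k} _) ⟩
    eval y x − eval z x                        ∎

  quotient : ∀ {k} → (Fin (suc k) → Carrier) → Carrier → Fin k → Carrier
  quotient {suc k} y r zero    = eval (y ∘ suc) r
  quotient {suc k} y r (suc j) = quotient (y ∘ suc) r j

  eval-division : ∀ {k} (y : Fin (suc k) → Carrier) r x →
                  eval y x ≈ (x − r) * eval (quotient y r) x + eval y r
  eval-division {zero}  y r x = trans (sym (+-identityˡ _)) (+-congʳ (sym (zeroʳ _)))
  eval-division {suc k} y r x = begin
    eval y x                                 ≈⟨ eval-suc y x ⟩
    y zero + x * eval (y ∘ suc) x            ≈⟨ +-congˡ (*-congˡ (eval-division (y ∘ suc) r x)) ⟩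
    y zero + x * ((x − r) * q + ρ)           ≈⟨ regroup (y zero) x r q ρ ⟩
    (x − r) * (ρ + x * q) + (y zero + r * ρ) ≈⟨ +-cong (*-congˡ (eval-suc (quotient y r) x)) (eval-suc y r) ⟨
    (x − r) * eval (quotient y r) x + eval y r ∎
    where
    q ρ : Carrier
    q = eval (quotient (y ∘ suc) r) x
    ρ = eval (y ∘ suc) r
    regroup : ∀ y₀ x r q ρ → y₀ + x * ((x − r) * q + ρ) ≈ (x − r) * (ρ + x * q) + (y₀ + r * ρ)
    regroup = solve 5 (λ y₀ x r q ρ → y₀ :+ x :* ((x :- r) :* q :+ ρ) := (x :- r) :* (ρ :+ x :* q) :+ (y₀ :+ r :* ρ)) refl

  k-roots⇒eval≈0 : ∀ {n} (S : Subset n) {t : Fin n → Carrier} → Injective _≡_ _≈_ t →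
                   ∀ {k} → k ℕ.≤ ∣ S ∣ → (y : Fin k → Carrier) →
                   (∀ u → u ∈ S → eval y (t u) ≈ 0#) → ∀ x → eval y x ≈ 0#
  k-roots⇒eval≈0 S t-inj {zero} _ y _ x = refl
  k-roots⇒eval≈0 (outside ∷ S) {t} t-inj {suc k} k≤∣S∣ y y≈0 =
    k-roots⇒eval≈0 S (Finₚ.suc-injective ∘ t-inj) k≤∣S∣ y (λ u u∈S → y≈0 (suc u) (there u∈S))
  k-roots⇒eval≈0 (inside ∷ S) {t} t-inj {suc k} (s≤s k≤∣S∣) y y≈0 x = begin
    eval y x                      ≈⟨ eval-division y r x ⟩
    (x − r) * eval q x + eval y r ≈⟨ +-cong (x≈0⇒y*x≈0 (x − r) (q≈0 x)) (y≈0 zero here) ⟩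
    0# + 0#                       ≈⟨ +-identityʳ 0# ⟩
    0#                            ∎
    where
    r : Carrier
    r = t zero
    q : Fin k → Carrier
    q = quotient y r
    q≈0 : ∀ x → eval q x ≈ 0#
    q≈0 = k-roots⇒eval≈0 S (Finₚ.suc-injective ∘ t-inj) k≤∣S∣ q λ u u∈S →
      x*y≈0⇒y≈0 (x≉y⇒x−y≉0 (λ tᵤ≈r → Finₚ.0≢1+n (≡.sym (t-inj tᵤ≈r)))) (begin
        (t (suc u) − r) * eval q (t (suc u))           ≈⟨ +-identityʳ _ ⟨
        (t (suc u) − r) * eval q (t (suc u)) + 0#      ≈⟨ +-congˡ (y≈0 zero here) ⟨
        (t (suc u) − r) * eval q (t (suc u)) + eval y r ≈⟨ eval-division y r (t (suc u)) ⟨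
        eval y (t (suc u))                             ≈⟨ y≈0 (suc u) (there u∈S) ⟩
        0#                                             ∎)

  eval-sum : ∀ {k m} (a : Fin m → Carrier) (p : Fin m → Fin k → Carrier) x →
             eval (λ j → sum (λ v → a v * p v j)) x ≈ sum (λ v → a v * eval (p v) x)
  eval-sum {k} {m} a p x = begin
    sum (λ j → x ^ toℕ j * sum (λ v → a v * p v j))
      ≈⟨ sum-cong-≋ {k} (λ j → *-distribˡ-sum {m} (x ^ toℕ j) _) ⟩
    sum (λ j → sum (λ v → x ^ toℕ j * (a v * p v j)))
      ≈⟨ ∑-comm (λ j v → x ^ toℕ j * (a v * p v j)) ⟩
    sum (λ v → sum (λ j → x ^ toℕ j * (a v * p v j)))
      ≈⟨ sum-cong-≋ {m} (λ v → eval-* (a v) (p v) x) ⟩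
    sum (λ v → a v * eval (p v) x) ∎

  𝟙[_] : ∀ {n} → Subset n → Fin n → Carrier
  𝟙[ S ] v with v Subsetₚ.∈? S
  ... | yes _ = 1#
  ... | no  _ = 0#

  𝟙-∈ : ∀ {n} (S : Subset n) {v} → v ∈ S → 𝟙[ S ] v ≈ 1#
  𝟙-∈ S {v} v∈S with v Subsetₚ.∈? S
  ... | yes _   = refl
  ... | no  v∉S = ⊥-elim (v∉S v∈S)

  𝟙-∉ : ∀ {n} (S : Subset n) {v} → v ∉ S → 𝟙[ S ] v ≈ 0#
  𝟙-∉ S {v} v∉S with v Subsetₚ.∈? S
  ... | yes v∈S = ⊥-elim (v∉S v∈S)
  ... | no  _   = refl

  nodal : ∀ {n} → Subset n → (Fin n → Carrier) → Carrier → Carrier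
  nodal []            t x = 1#
  nodal (inside ∷ S)  t x = (x − t zero) * nodal S (t ∘ suc) x
  nodal (outside ∷ S) t x = nodal S (t ∘ suc) x

  nodal-root : ∀ {n} (S : Subset n) t {u} → u ∈ S → nodal S t (t u) ≈ 0#
  nodal-root (inside ∷ S)  t here        = trans (*-congʳ (-‿inverseʳ (t zero))) (zeroˡ _)
  nodal-root (inside ∷ S)  t (there u∈S) = x≈0⇒y*x≈0 _ (nodal-root S (t ∘ suc) u∈S)
  nodal-root (outside ∷ S) t (there u∈S) = nodal-root S (t ∘ suc) u∈S

  nodal-≉0 : ∀ {n} (S : Subset n) t {x} → (∀ u → u ∈ S → x ≉ t u) → nodal S t x ≉ 0#
  nodal-≉0 []            t x≉t = 1≉0
  nodal-≉0 (inside ∷ S)  t x≉t =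
    x≉0∧y≉0⇒x*y≉0 (x≉y⇒x−y≉0 (x≉t zero here)) (nodal-≉0 S (t ∘ suc) (λ u → x≉t (suc u) ∘ there))
  nodal-≉0 (outside ∷ S) t x≉t = nodal-≉0 S (t ∘ suc) (λ u → x≉t (suc u) ∘ there)

  nodal-remove : ∀ {n} (S : Subset n) t {u} x → u ∈ S → nodal S t x ≈ (x − t u) * nodal (S - u) t x
  nodal-remove (inside ∷ S) t x here =
    *-congˡ (reflexive (≡.cong (λ S′ → nodal S′ (t ∘ suc) x) (≡.sym (Subsetₚ.p─⊥≡p S))))
  nodal-remove (inside ∷ S) t x (there u∈S) =
    trans (*-congˡ (nodal-remove S (t ∘ suc) x u∈S)) (x*yz≈y*xz _ _ _)
  nodal-remove (outside ∷ S) t x (there u∈S) = nodal-remove S (t ∘ suc) x u∈S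

  nodal-∩─ : ∀ {n} (S S′ : Subset n) t x → nodal S t x ≈ nodal (S ∩ S′) t x * nodal (S ─ S′) t x
  nodal-∩─ []            []             t x = sym (*-identityˡ 1#)
  nodal-∩─ (inside ∷ S)  (inside ∷ S′)  t x =
    trans (*-congˡ (nodal-∩─ S S′ (t ∘ suc) x)) (sym (*-assoc _ _ _))
  nodal-∩─ (inside ∷ S)  (outside ∷ S′) t x =
    trans (*-congˡ (nodal-∩─ S S′ (t ∘ suc) x)) (x*yz≈y*xz _ _ _)
  nodal-∩─ (outside ∷ S) (inside ∷ S′)  t x = nodal-∩─ S S′ (t ∘ suc) x
  nodal-∩─ (outside ∷ S) (outside ∷ S′) t x = nodal-∩─ S S′ (t ∘ suc) x

  nodal-empty : ∀ {n} (S : Subset n) t x → ∣ S ∣ ≡ 0 → nodal S t x ≈ 1#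
  nodal-empty []            t x _ = refl
  nodal-empty (outside ∷ S) t x e = nodal-empty S (t ∘ suc) x e

  nodal-pair : ∀ {n} (S : Subset n) t → ∣ S ∣ ≡ 2 →
               ∃₂ λ p q → p ∈ S × q ∈ S × p ≢ q × (∀ x → nodal S t x ≈ (x − t p) * (x − t q))
  nodal-pair S t ∣S∣≡2 with ∣p∣≡1+m⇒nonempty S ∣S∣≡2
  ... | p , p∈S with ∣p∣≡1+m⇒nonempty (S - p) (∣p-x∣≡m S p∈S ∣S∣≡2)
  ... | q , q∈S-p = p , q , p∈S , x∈p-y⇒x∈p S p q∈S-p , x∈p-y⇒x≢y S p q∈S-p ∘ ≡.sym , λ x → begin
    nodal S t x                                     ≈⟨ nodal-remove S t x p∈S ⟩
    (x − t p) * nodal (S - p) t x                   ≈⟨ *-congˡ (nodal-remove (S - p) t x q∈S-p) ⟩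
    (x − t p) * ((x − t q) * nodal (S - p - q) t x) ≈⟨ *-congˡ (*-congˡ (nodal-empty (S - p - q) t x ∣S-p-q∣≡0)) ⟩
    (x − t p) * ((x − t q) * 1#)                    ≈⟨ *-congˡ (*-identityʳ _) ⟩
    (x − t p) * (x − t q)                           ∎
    where
    ∣S-p-q∣≡0 : ∣ S - p - q ∣ ≡ 0
    ∣S-p-q∣≡0 = ∣p-x∣≡m (S - p) q∈S-p (∣p-x∣≡m S p∈S ∣S∣≡2)

  evalList : List Carrier → Carrier → Carrier
  evalList []       x = 0#
  evalList (a ∷ as) x = a + x * evalList as x

  addHead : Carrier → List Carrier → List Carrier
  addHead a []       = a ∷ []
  addHead a (b ∷ bs) = (a + b) ∷ bs

  evalList-addHead : ∀ a as x → evalList (addHead a as) x ≈ a + evalList as x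
  evalList-addHead a []       x = +-congˡ (zeroʳ x)
  evalList-addHead a (b ∷ bs) x = +-assoc a b _

  length-addHead : ∀ a as → ℕ.NonZero (length as) → length (addHead a as) ≡ length as
  length-addHead a (b ∷ bs) _ = ≡.refl

  mulLinear : Carrier → List Carrier → List Carrier
  mulLinear r []       = 0# ∷ []
  mulLinear r (a ∷ as) = - (r * a) ∷ addHead a (mulLinear r as)

  evalList-mulLinear : ∀ r as x → evalList (mulLinear r as) x ≈ (x − r) * evalList as x
  evalList-mulLinear r []       x = trans (trans (+-congˡ (zeroʳ x)) (+-identityˡ 0#)) (sym (zeroʳ _))
  evalList-mulLinear r (a ∷ as) x = begin
    - (r * a) + x * evalList (addHead a (mulLinear r as)) x
      ≈⟨ +-congˡ (*-congˡ (trans (evalList-addHead a (mulLinear r as) x) (+-congˡ (evalList-mulLinear r as x)))) ⟩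
    - (r * a) + x * (a + (x − r) * evalList as x)
      ≈⟨ solve 4 (λ x r a e → :- (r :* a) :+ x :* (a :+ (x :- r) :* e) := (x :- r) :* (a :+ x :* e)) refl x r a (evalList as x) ⟩
    (x − r) * (a + x * evalList as x) ∎

  length-mulLinear : ∀ r as → length (mulLinear r as) ≡ suc (length as)
  length-mulLinear r []       = ≡.refl
  length-mulLinear r (a ∷ as) =
    ≡.cong suc (≡.trans (length-addHead a (mulLinear r as) (≡.subst ℕ.NonZero (≡.sym (length-mulLinear r as)) _))
                        (length-mulLinear r as))

  nodalList : ∀ {n} → Subset n → (Fin n → Carrier) → List Carrier
  nodalList []            t = 1# ∷ []
  nodalList (inside ∷ S)  t = mulLinear (t zero) (nodalList S (t ∘ suc))
  nodalList (outside ∷ S) t = nodalList S (t ∘ suc)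

  evalList-nodalList : ∀ {n} (S : Subset n) t x → evalList (nodalList S t) x ≈ nodal S t x
  evalList-nodalList []            t x = trans (+-congˡ (zeroʳ x)) (+-identityʳ 1#)
  evalList-nodalList (inside ∷ S)  t x =
    trans (evalList-mulLinear (t zero) (nodalList S (t ∘ suc)) x) (*-congˡ (evalList-nodalList S (t ∘ suc) x))
  evalList-nodalList (outside ∷ S) t x = evalList-nodalList S (t ∘ suc) x

  length-nodalList : ∀ {n} (S : Subset n) t → length (nodalList S t) ≡ suc ∣ S ∣
  length-nodalList []            t = ≡.refl
  length-nodalList (inside ∷ S)  t =
    ≡.trans (length-mulLinear (t zero) (nodalList S (t ∘ suc))) (≡.cong suc (length-nodalList S (t ∘ suc)))
  length-nodalList (outside ∷ S) t = length-nodalList S (t ∘ suc)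

  pad : (k : ℕ) → List Carrier → Fin k → Carrier
  pad (suc k) []       j       = 0#
  pad (suc k) (a ∷ as) zero    = a
  pad (suc k) (a ∷ as) (suc j) = pad k as j

  eval-pad : ∀ k as x → length as ℕ.≤ k → eval (pad k as) x ≈ evalList as x
  eval-pad zero    []       x _ = refl
  eval-pad (suc k) []       x _ = trans (sum-cong-≋ {suc k} (λ j → zeroʳ (x ^ toℕ j))) (sum-replicate-zero (suc k))
  eval-pad (suc k) (a ∷ as) x (s≤s ∣as∣≤k) =
    trans (eval-suc (pad (suc k) (a ∷ as)) x) (+-congˡ (*-congˡ (eval-pad k as x ∣as∣≤k)))

  nodalCoeffs : ∀ {n} (k : ℕ) → Subset n → (Fin n → Carrier) → Fin k → Carrier
  nodalCoeffs k S t = pad k (nodalList S t)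

  eval-nodalCoeffs : ∀ {n} k (S : Subset n) t → suc ∣ S ∣ ℕ.≤ k → ∀ x → eval (nodalCoeffs k S t) x ≈ nodal S t x
  eval-nodalCoeffs k S t ∣S∣<k x = trans (eval-pad k (nodalList S t) x (ℕₚ.≤-trans (ℕₚ.≤-reflexive (length-nodalList S t)) ∣S∣<k))
                                         (evalList-nodalList S t x)

  -- Arrangements on the moment curve

  momentCurve : ∀ {n k} → (Fin n → Carrier) → Fin n → Fin k → Carrier
  momentCurve t i j = t i ^ toℕ j

  module MomentCurve {n k : ℕ} (t : Fin n → Carrier) (t-inj : Injective _≡_ _≈_ t) where

    α : Fin n → Fin k → Carrier
    α = momentCurve t

    α·y≈eval : ∀ i y → α i · y ≈ eval y (t i)
    α·y≈eval i y = reflexive (Σᶠ≡sum (λ j → α i j * y j))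

    eval≈x : ∀ {K : Subset n} {x : Fin n → Carrier} (y : Fin k → Carrier) →
             (∀ u → u ∈ K → α u · y ≈ x u) → ∀ {u} → u ∈ K → eval y (t u) ≈ x u
    eval≈x y y≈x {u} u∈K = trans (sym (α·y≈eval u y)) (y≈x u u∈K)

    nodal-≉0-outside : ∀ (S : Subset n) {a} → a ∉ S → nodal S t (t a) ≉ 0#
    nodal-≉0-outside S a∉S = nodal-≉0 S t (λ u u∈S tₐ≈tᵤ → a∉S (≡.subst (_∈ S) (≡.sym (t-inj tₐ≈tᵤ)) u∈S))

    multiple-of-nodal∈D : ∀ K (S : Subset n) γ {x} → suc ∣ S ∣ ℕ.≤ k →
                          (∀ u → u ∈ K → x u ≈ γ * nodal S t (t u)) → D α K x
    multiple-of-nodal∈D K S γ {x} ∣S∣<k x≈ = y , λ u u∈K → begin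
      α u · y                            ≈⟨ α·y≈eval u y ⟩
      eval y (t u)                       ≈⟨ eval-* γ (nodalCoeffs k S t) (t u) ⟩
      γ * eval (nodalCoeffs k S t) (t u) ≈⟨ *-congˡ (eval-nodalCoeffs k S t ∣S∣<k (t u)) ⟩
      γ * nodal S t (t u)                ≈⟨ x≈ u u∈K ⟨
      x u                                ∎
      where
      y : Fin k → Carrier
      y j = γ * nodalCoeffs k S t j

    D∧vanishing⇒≈0 : ∀ {K w x} → IsIndex k K → w ∈ K → D α K x →
                     (∀ u → u ∈ K - w → x u ≈ 0#) → x w ≈ 0#
    D∧vanishing⇒≈0 {K} {w} {x} ∣K∣≡k+1 w∈K (y , y≈x) x≈0 = begin
      x w          ≈⟨ y≈x w w∈K ⟨
      α w · y      ≈⟨ α·y≈eval w y ⟩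
      eval y (t w) ≈⟨ k-roots⇒eval≈0 (K - w) t-inj k≤∣K-w∣ y y≈0 (t w) ⟩
      0#           ∎
      where
      k≤∣K-w∣ : k ℕ.≤ ∣ K - w ∣
      k≤∣K-w∣ = ℕₚ.≤-reflexive (≡.sym (∣p-x∣≡m K w∈K ∣K∣≡k+1))
      y≈0 : ∀ u → u ∈ K - w → eval y (t u) ≈ 0#
      y≈0 u u∈K-w = trans (eval≈x y y≈x (x∈p-y⇒x∈p K w u∈K-w)) (x≈0 u u∈K-w)

    vanishing⇒multiple-of-nodal : ∀ (S : Subset n) {a} → a ∉ S → suc ∣ S ∣ ≡ k → (y : Fin k → Carrier) →
                                  (∀ u → u ∈ S → eval y (t u) ≈ 0#) →
                                  ∃ λ γ → ∀ x → eval y x ≈ γ * nodal S t x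
    vanishing⇒multiple-of-nodal S {a} a∉S ∣S∣≡k y y≈0 = γ , λ x → x−y≈0⇒x≈y (begin
      eval y x − γ * nodal S t x ≈⟨ eval-z x ⟨
      eval z x                   ≈⟨ k-roots⇒eval≈0 (S ∪ ⁅ a ⁆) t-inj k≤∣S∪a∣ z z≈0 x ⟩
      0#                         ∎)
      where
      ∣S∣<k : suc ∣ S ∣ ℕ.≤ k
      ∣S∣<k = ℕₚ.≤-reflexive ∣S∣≡k
      ω γω z : Fin k → Carrier
      ω = nodalCoeffs k S t
      ωₐ≉0 : nodal S t (t a) ≉ 0#
      ωₐ≉0 = nodal-≉0-outside S a∉S
      γ : Carrier
      γ = eval y (t a) * inv (nodal S t (t a)) ωₐ≉0
      γω j = γ * ω j
      z j = y j − γω j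
      eval-z : ∀ x → eval z x ≈ eval y x − γ * nodal S t x
      eval-z x = trans (eval-− y γω x) (+-congˡ (-‿cong (trans (eval-* γ ω x) (*-congˡ (eval-nodalCoeffs k S t ∣S∣<k x)))))
      k≤∣S∪a∣ : k ℕ.≤ ∣ S ∪ ⁅ a ⁆ ∣
      k≤∣S∪a∣ = ℕₚ.≤-trans (ℕₚ.≤-reflexive (≡.sym ∣S∣≡k))
        (Subsetₚ.p⊂q⇒∣p∣<∣q∣ (Subsetₚ.p⊆p∪q _ , a , Subsetₚ.x∈p∪q⁺ (inj₂ (Subsetₚ.x∈⁅x⁆ a)) , a∉S))
      z≈0 : ∀ u → u ∈ S ∪ ⁅ a ⁆ → eval z (t u) ≈ 0#
      z≈0 u u∈S∪a with Subsetₚ.x∈p∪q⁻ S ⁅ a ⁆ u∈S∪a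
      ... | inj₁ u∈S = trans (eval-z (t u)) (x≈y⇒x−y≈0 (trans (y≈0 u u∈S) (sym (x≈0⇒y*x≈0 γ (nodal-root S t u∈S)))))
      ... | inj₂ u∈a rewrite Subsetₚ.x∈⁅y⁆⇒x≡y a u∈a = trans (eval-z (t a)) (x≈y⇒x−y≈0 (begin
        eval y (t a)                             ≈⟨ *-identityʳ _ ⟨
        eval y (t a) * 1#                        ≈⟨ *-congˡ (*-inverseˡ _ ωₐ≉0) ⟨
        eval y (t a) * (inv _ ωₐ≉0 * nodal S t (t a)) ≈⟨ *-assoc _ _ _ ⟨
        γ * nodal S t (t a)                      ∎))

    momentCurve-generic : IsGeneric α
    momentCurve-generic s s-inj λs Σλα≈0 j₀ = x*y≈0⇒y≈0 (nodal-≉0 S p p₀∉S) (trans (*-comm _ _) λ₀ω₀≈0)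
      where
      p : Fin k → Carrier
      p = t ∘ s
      S : Subset k
      S = ⊤ - j₀
      y : Fin k → Carrier
      y = nodalCoeffs k S p
      eval-y : ∀ x → eval y x ≈ nodal S p x
      eval-y = eval-nodalCoeffs k S p (ℕₚ.≤-reflexive (≡.trans (∣p-x∣ {x = j₀} ⊤ Subsetₚ.∈⊤) (Subsetₚ.∣⊤∣≡n k)))
      p₀∉S : ∀ u → u ∈ S → p j₀ ≉ p u
      p₀∉S u u∈S p₀≈pᵤ = x∈p-y⇒x≢y ⊤ j₀ u∈S (≡.sym (s-inj j₀ u (t-inj p₀≈pᵤ)))
      Σλy≈0 : sum (λ j → λs j * eval y (p j)) ≈ 0#
      Σλy≈0 = begin
        sum (λ j → λs j * eval y (p j))
          ≈⟨ sum-cong-≋ {k} (λ j → *-distribˡ-sum {k} (λs j) _) ⟩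
        sum (λ j → sum (λ m → λs j * (p j ^ toℕ m * y m)))
          ≈⟨ ∑-comm (λ j m → λs j * (p j ^ toℕ m * y m)) ⟩
        sum (λ m → sum (λ j → λs j * (p j ^ toℕ m * y m)))
          ≈⟨ sum-cong-≋ {k} (λ m → trans (sum-cong-≋ {k} (λ j → sym (*-assoc _ _ (y m))))
                                          (sym (*-distribʳ-sum {k} (y m) _))) ⟩
        sum (λ m → sum (λ j → λs j * α (s j) m) * y m)
          ≈⟨ sum-cong-≋ {k} (λ m → trans (*-congʳ (trans (reflexive (≡.sym (Σᶠ≡sum (λ j → λs j * α (s j) m)))) (Σλα≈0 m))) (zeroˡ (y m))) ⟩
        sum {k} (λ _ → 0#)
          ≈⟨ sum-replicate-zero k ⟩
        0# ∎
      λ₀ω₀≈0 : λs j₀ * nodal S p (p j₀) ≈ 0#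
      λ₀ω₀≈0 = begin
        λs j₀ * nodal S p (p j₀)        ≈⟨ *-congˡ (eval-y (p j₀)) ⟨
        λs j₀ * eval y (p j₀)           ≈⟨ sum-single (λ j → λs j * eval y (p j)) j₀ others≈0 ⟨
        sum (λ j → λs j * eval y (p j)) ≈⟨ Σλy≈0 ⟩
        0#                              ∎
        where
        others≈0 : ∀ j → j ≢ j₀ → λs j * eval y (p j) ≈ 0#
        others≈0 j j≢j₀ = x≈0⇒y*x≈0 (λs j)
          (trans (eval-y (p j)) (nodal-root S p (Subsetₚ.x∈p∧x≢y⇒x∈p-y Subsetₚ.∈⊤ j≢j₀)))

    module Lagrange {K : Subset n} {w : Fin n} (∣K∣≡k+1 : IsIndex k K) (w∈K : w ∈ K) where

      S : Subset n
      S = K - w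

      ∣S∣≡k : ∣ S ∣ ≡ k
      ∣S∣≡k = ∣p-x∣≡m K w∈K ∣K∣≡k+1

      ωᵤ≉0 : ∀ u → nodal (S - u) t (t u) ≉ 0#
      ωᵤ≉0 u = nodal-≉0-outside (S - u) (λ u∈S-u → x∈p-y⇒x≢y S u u∈S-u ≡.refl)

      basis : Fin n → Fin k → Carrier
      basis u j = inv _ (ωᵤ≉0 u) * nodalCoeffs k (S - u) t j

      eval-basis : ∀ {u} → u ∈ S → ∀ x → eval (basis u) x ≈ inv _ (ωᵤ≉0 u) * nodal (S - u) t x
      eval-basis {u} u∈S x = trans (eval-* _ (nodalCoeffs k (S - u) t) x)
        (*-congˡ (eval-nodalCoeffs k (S - u) t (ℕₚ.≤-reflexive (≡.trans (∣p-x∣ S u∈S) ∣S∣≡k)) x))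

      basis-self : ∀ {u} → u ∈ S → eval (basis u) (t u) ≈ 1#
      basis-self {u} u∈S = trans (eval-basis u∈S (t u)) (*-inverseˡ _ (ωᵤ≉0 u))

      basis-other : ∀ {u v} → u ∈ S → v ∈ S → v ≢ u → eval (basis u) (t v) ≈ 0#
      basis-other {u} {v} u∈S v∈S v≢u = trans (eval-basis u∈S (t v))
        (x≈0⇒y*x≈0 _ (nodal-root (S - u) t (Subsetₚ.x∈p∧x≢y⇒x∈p-y v∈S v≢u)))

      interpolant : (Fin n → Carrier) → Fin k → Carrier
      interpolant a j = sum (λ v → (𝟙[ S ] v * a v) * basis v j)

      eval-interpolant : ∀ a x → eval (interpolant a) x ≈ sum (λ v → (𝟙[ S ] v * a v) * eval (basis v) x)
      eval-interpolant a = eval-sum (λ v → 𝟙[ S ] v * a v) basis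

      interpolant-agrees : ∀ a {u} → u ∈ S → eval (interpolant a) (t u) ≈ a u
      interpolant-agrees a {u} u∈S = begin
        eval (interpolant a) (t u)                           ≈⟨ eval-interpolant a (t u) ⟩
        sum (λ v → (𝟙[ S ] v * a v) * eval (basis v) (t u)) ≈⟨ sum-single _ u others≈0 ⟩
        (𝟙[ S ] u * a u) * eval (basis u) (t u)             ≈⟨ *-cong 𝟙a≈a (basis-self u∈S) ⟩
        a u * 1#                                             ≈⟨ *-identityʳ _ ⟩
        a u                                                  ∎
        where
        𝟙a≈a : 𝟙[ S ] u * a u ≈ a u
        𝟙a≈a = trans (*-congʳ (𝟙-∈ S u∈S)) (*-identityˡ _)
        others≈0 : ∀ v → v ≢ u → (𝟙[ S ] v * a v) * eval (basis v) (t u) ≈ 0#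
        others≈0 v v≢u = by-cases (v Subsetₚ.∈? S)
          where
          by-cases : Dec (v ∈ S) → (𝟙[ S ] v * a v) * eval (basis v) (t u) ≈ 0#
          by-cases (yes v∈S) = x≈0⇒y*x≈0 _ (basis-other v∈S u∈S (v≢u ∘ ≡.sym))
          by-cases (no  v∉S) = trans (*-congʳ (trans (*-congʳ (𝟙-∉ S v∉S)) (zeroˡ (a v)))) (zeroˡ _)

      interpolant-unique : ∀ a y → (∀ u → u ∈ S → eval y (t u) ≈ a u) →
                           ∀ x → eval y x ≈ eval (interpolant a) x
      interpolant-unique a y y≈a x = x−y≈0⇒x≈y (trans (sym (eval-− y (interpolant a) x))
        (k-roots⇒eval≈0 S t-inj (ℕₚ.≤-reflexive (≡.sym ∣S∣≡k)) _ difference≈0 x))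
        where
        difference≈0 : ∀ u → u ∈ S → eval (λ j → y j − interpolant a j) (t u) ≈ 0#
        difference≈0 u u∈S = trans (eval-− y (interpolant a) (t u))
          (x≈y⇒x−y≈0 (trans (y≈a u u∈S) (sym (interpolant-agrees a u∈S))))

      equation : Fin n → Carrier
      equation v = 𝟙[ S ] v * eval (basis v) (t w) − 𝟙[ ⁅ w ⁆ ] v

      equation·x : ∀ x → equation · x ≈ eval (interpolant x) (t w) − x w
      equation·x x = begin
        equation · x
          ≡⟨ Σᶠ≡sum (λ v → equation v * x v) ⟩
        sum (λ v → equation v * x v)
          ≈⟨ sum-cong-≋ {n} (λ v → expand (𝟙[ S ] v) (eval (basis v) (t w)) (𝟙[ ⁅ w ⁆ ] v) (x v)) ⟩
        sum (λ v → (𝟙[ S ] v * x v) * eval (basis v) (t w) + - (𝟙[ ⁅ w ⁆ ] v * x v))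
          ≈⟨ ∑-distrib-+ {n} _ _ ⟩
        sum (λ v → (𝟙[ S ] v * x v) * eval (basis v) (t w)) + sum (λ v → - (𝟙[ ⁅ w ⁆ ] v * x v))
          ≈⟨ +-cong (sym (eval-interpolant x (t w))) (sum-neg {n} _) ⟩
        eval (interpolant x) (t w) − sum (λ v → 𝟙[ ⁅ w ⁆ ] v * x v)
          ≈⟨ +-congˡ (-‿cong (trans (sum-single _ w others≈0) (trans (*-congʳ (𝟙-∈ ⁅ w ⁆ (Subsetₚ.x∈⁅x⁆ w))) (*-identityˡ _)))) ⟩
        eval (interpolant x) (t w) − x w ∎
        where
        expand : ∀ a b d y → (a * b − d) * y ≈ (a * y) * b + - (d * y)
        expand = solve 4 (λ a b d y → (a :* b :- d) :* y := (a :* y) :* b :+ :- (d :* y)) refl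
        others≈0 : ∀ v → v ≢ w → 𝟙[ ⁅ w ⁆ ] v * x v ≈ 0#
        others≈0 v v≢w = trans (*-congʳ (𝟙-∉ ⁅ w ⁆ (v≢w ∘ Subsetₚ.x∈⁅y⁆⇒x≡y w))) (zeroˡ (x v))

      equation-w : equation w ≈ - 1#
      equation-w = trans (+-cong (trans (*-congʳ (𝟙-∉ S w∉S)) (zeroˡ _)) (-‿cong (𝟙-∈ ⁅ w ⁆ (Subsetₚ.x∈⁅x⁆ w))))
                         (+-identityˡ _)
        where
        w∉S : w ∉ S
        w∉S w∈S = x∈p-y⇒x≢y K w w∈S ≡.refl

      equation-outside : ∀ v → v ∉ K → equation v ≈ 0#
      equation-outside v v∉K = trans (+-cong (trans (*-congʳ (𝟙-∉ S (v∉K ∘ x∈p-y⇒x∈p K w))) (zeroˡ _))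
                                             (-‿cong (𝟙-∉ ⁅ w ⁆ v∉⁅w⁆)))
                                     (trans (+-identityˡ _) -0≈0)
        where
        v∉⁅w⁆ : v ∉ ⁅ w ⁆
        v∉⁅w⁆ v∈⁅w⁆ = v∉K (≡.subst (_∈ K) (≡.sym (Subsetₚ.x∈⁅y⁆⇒x≡y w v∈⁅w⁆)) w∈K)

      D⇒equation : ∀ x → D α K x → equation · x ≈ 0#
      D⇒equation x (y , y≈x) = trans (equation·x x) (x≈y⇒x−y≈0 (begin
        eval (interpolant x) (t w) ≈⟨ interpolant-unique x y y≈x′ (t w) ⟨
        eval y (t w)               ≈⟨ α·y≈eval w y ⟨
        α w · y                    ≈⟨ y≈x w w∈K ⟩
        x w                        ∎))
        where
        y≈x′ : ∀ u → u ∈ S → eval y (t u) ≈ x u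
        y≈x′ u u∈S = trans (sym (α·y≈eval u y)) (y≈x u (x∈p-y⇒x∈p K w u∈S))

      equation⇒D : ∀ x → equation · x ≈ 0# → D α K x
      equation⇒D x e = interpolant x , λ u u∈K → trans (α·y≈eval u (interpolant x)) (agrees u∈K)
        where
        agrees : ∀ {u} → u ∈ K → eval (interpolant x) (t u) ≈ x u
        agrees {u} u∈K with u Finₚ.≟ w
        ... | yes ≡.refl = x−y≈0⇒x≈y (trans (sym (equation·x x)) e)
        ... | no  u≢w    = interpolant-agrees x (Subsetₚ.x∈p∧x≢y⇒x∈p-y u∈K u≢w)

    D-hyperplane : ∀ {K w} → IsIndex k K → w ∈ K →
                   ∃ λ (f : Fin n → Carrier) → f w ≈ - 1# × (∀ v → v ∉ K → f v ≈ 0#) ×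
                     (∀ x → (D α K x → f · x ≈ 0#) × (f · x ≈ 0# → D α K x))
    D-hyperplane ∣K∣≡k+1 w∈K = equation , equation-w , equation-outside , λ x → D⇒equation x , equation⇒D x
      where open Lagrange ∣K∣≡k+1 w∈K

    vanishing∈D : ∀ K {x} → (∀ u → u ∈ K → x u ≈ 0#) → D α K x
    vanishing∈D K x≈0 = pad k [] , λ u u∈K →
      trans (α·y≈eval u (pad k [])) (trans (eval-pad k [] (t u) z≤n) (sym (x≈0 u u∈K)))

    𝟙⁅m⁆∈D : ∀ {K m} → m ∉ K → D α K 𝟙[ ⁅ m ⁆ ]
    𝟙⁅m⁆∈D {K} {m} m∉K = vanishing∈D K λ u u∈K →
      𝟙-∉ ⁅ m ⁆ (λ u∈⁅m⁆ → m∉K (≡.subst (_∈ K) (Subsetₚ.x∈⁅y⁆⇒x≡y m u∈⁅m⁆) u∈K))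

    𝟙⁅m⁆∉D : ∀ {K m} → IsIndex k K → m ∈ K → ¬ D α K 𝟙[ ⁅ m ⁆ ]
    𝟙⁅m⁆∉D {K} {m} ∣K∣≡k+1 m∈K 𝟙∈D = 1≉0 (begin
      1#              ≈⟨ 𝟙-∈ ⁅ m ⁆ (Subsetₚ.x∈⁅x⁆ m) ⟨
      𝟙[ ⁅ m ⁆ ] m    ≈⟨ D∧vanishing⇒≈0 ∣K∣≡k+1 m∈K 𝟙∈D (λ u u∈K-m → 𝟙-∉ ⁅ m ⁆ (x∈p-y⇒x≢y K m u∈K-m ∘ Subsetₚ.x∈⁅y⁆⇒x≡y m)) ⟩
      0#              ∎)

    D-distinct : ∀ {K K′ m} → IsIndex k K′ → m ∉ K → m ∈ K′ → ¬ (D α K ≐ D α K′)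
    D-distinct ∣K′∣≡k+1 m∉K m∈K′ (D⊆D′ , _) = 𝟙⁅m⁆∉D ∣K′∣≡k+1 m∈K′ (D⊆D′ _ (𝟙⁅m⁆∈D m∉K))

    D∩D-codim2 : ∀ {K K′ w w′} → IsIndex k K → IsIndex k K′ → w ∈ K → w ∉ K′ → w′ ∈ K′ → w′ ∉ K →
                 IsCodim2Subspace (λ x → D α K x × D α K′ x)
    D∩D-codim2 {w = w} {w′} ∣K∣≡k+1 ∣K′∣≡k+1 w∈K w∉K′ w′∈K′ w′∉K
      with D-hyperplane ∣K∣≡k+1 w∈K | D-hyperplane ∣K′∣≡k+1 w′∈K′
    ... | f , f[w]≈-1 , f-outside , D⇔f | f′ , f′[w′]≈-1 , f′-outside , D′⇔f′ =
      f , f′ , independent , λ x → (λ (d , d′) → proj₁ (D⇔f x) d , proj₁ (D′⇔f′ x) d′)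
                               , (λ (e , e′) → proj₂ (D⇔f x) e , proj₂ (D′⇔f′ x) e′)
      where
      a*-1+b*0≈0⇒a≈0 : ∀ {a b} → a * - 1# + b * 0# ≈ 0# → a ≈ 0#
      a*-1+b*0≈0⇒a≈0 {a} {b} e = begin
        a                   ≈⟨ ⁻¹-involutive a ⟨
        - - a               ≈⟨ -‿cong (trans (*-comm a (- 1#)) (-1*x≈-x a)) ⟨
        - (a * - 1#)        ≈⟨ -‿cong (trans (+-congˡ (zeroʳ b)) (+-identityʳ _)) ⟨
        - (a * - 1# + b * 0#) ≈⟨ -‿cong e ⟩
        - 0#                ≈⟨ -0≈0 ⟩
        0#                  ∎
      independent : ∀ a b → (∀ i → a * f i + b * f′ i ≈ 0#) → (a ≈ 0#) × (b ≈ 0#)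
      independent a b comb≈0 =
        a*-1+b*0≈0⇒a≈0 (trans (sym (+-cong (*-congˡ f[w]≈-1) (*-congˡ (f′-outside w w∉K′)))) (comb≈0 w)) ,
        a*-1+b*0≈0⇒a≈0 (trans (sym (+-cong (*-congˡ f′[w′]≈-1) (*-congˡ (f-outside w′ w′∉K)))) (trans (+-comm _ _) (comb≈0 w′)))

  module Construction (char0 : HasCharZero) (k′ r : ℕ) where

    pattern ∈₀ = here
    pattern ∈₁ = there ∈₀
    pattern ∈₂ = there ∈₁
    pattern ∈₃ = there ∈₂
    pattern ∈₄ = there ∈₃
    pattern ∈₅ = there ∈₄
    pattern ∈₆₊ v∈ = there (there (there (there (there (there v∈)))))
    pattern 6+ v = suc (suc (suc (suc (suc (suc v)))))

    k n : ℕ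
    k = 3 ℕ.+ k′
    n = 6 ℕ.+ (k′ ℕ.+ r)

    -- The node pairs {4,10}, {6,8}, {5,9} share the sum 14; no other two nodes of K₁ do.
    nodeℕ : ℕ → ℕ
    nodeℕ 0 = 4
    nodeℕ 1 = 10
    nodeℕ 2 = 6
    nodeℕ 3 = 8
    nodeℕ 4 = 5
    nodeℕ 5 = 9
    nodeℕ (6+ m) = 11 ℕ.+ m

    positionℕ : ℕ → ℕ
    positionℕ 4  = 0
    positionℕ 10 = 1
    positionℕ 6  = 2
    positionℕ 8  = 3
    positionℕ 5  = 4
    positionℕ 9  = 5
    positionℕ (suc (suc (suc (suc (suc (6+ m)))))) = 6 ℕ.+ m
    positionℕ _  = 0

    positionℕ∘nodeℕ : ∀ a → positionℕ (nodeℕ a) ≡ a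
    positionℕ∘nodeℕ 0      = ≡.refl
    positionℕ∘nodeℕ 1      = ≡.refl
    positionℕ∘nodeℕ 2      = ≡.refl
    positionℕ∘nodeℕ 3      = ≡.refl
    positionℕ∘nodeℕ 4      = ≡.refl
    positionℕ∘nodeℕ 5      = ≡.refl
    positionℕ∘nodeℕ (6+ m) = ≡.refl

    node : Fin n → ℕ
    node u = nodeℕ (toℕ u)

    node-injective : ∀ {u v} → node u ≡ node v → u ≡ v
    node-injective {u} {v} e = Finₚ.toℕ-injective
      (≡.trans (≡.sym (positionℕ∘nodeℕ (toℕ u))) (≡.trans (≡.cong positionℕ e) (positionℕ∘nodeℕ (toℕ v))))

    t : Fin n → Carrier
    t u = ℕ→F (node u)

    t-inj : Injective _≡_ _≈_ t
    t-inj = node-injective ∘ ℕ→F-injective char0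

    open MomentCurve {n} {k} t t-inj

    T : Subset (k′ ℕ.+ r)
    T = replicate k′ true ++ replicate r false

    ∣T∣≡k′ : ∣ T ∣ ≡ k′
    ∣T∣≡k′ = go k′
      where
      go : ∀ m → ∣ replicate m true ++ replicate r false ∣ ≡ m
      go zero    = Subsetₚ.∣⊥∣≡0 r
      go (suc m) = ≡.cong suc (go m)

    mk : (b₀ b₁ b₂ b₃ b₄ b₅ : Bool) → Subset n
    mk b₀ b₁ b₂ b₃ b₄ b₅ = b₀ ∷ b₁ ∷ b₂ ∷ b₃ ∷ b₄ ∷ b₅ ∷ T

    -- Kᵢ omits the i-th of the pairs {0,1}, {2,3}, {4,5} from U, and Iᵢⱼ = Kᵢ ∩ Kⱼ.
    U K₁ K₂ K₃ I₁₂ I₁₃ I₂₃ : Subset n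
    U   = mk true  true  true  true  true  true
    K₁  = mk false false true  true  true  true
    K₂  = mk true  true  false false true  true
    K₃  = mk true  true  true  true  false false
    I₁₂ = mk false false false false true  true
    I₁₃ = mk false false true  true  false false
    I₂₃ = mk true  true  false false false false

    ∣K₁∣ : IsIndex k K₁
    ∣K₁∣ = ≡.cong (4 ℕ.+_) ∣T∣≡k′

    ∣K₂∣ : IsIndex k K₂
    ∣K₂∣ = ≡.cong (4 ℕ.+_) ∣T∣≡k′

    ∣K₃∣ : IsIndex k K₃
    ∣K₃∣ = ≡.cong (4 ℕ.+_) ∣T∣≡k′

    ∣I₂₃∣ : suc ∣ I₂₃ ∣ ≡ k
    ∣I₂₃∣ = ≡.cong (3 ℕ.+_) ∣T∣≡k′

    ∣I₁₂∣<k : suc ∣ I₁₂ ∣ ℕ.≤ k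
    ∣I₁₂∣<k = ℕₚ.≤-reflexive (≡.cong (3 ℕ.+_) ∣T∣≡k′)

    ∣I₁₃∣<k : suc ∣ I₁₃ ∣ ℕ.≤ k
    ∣I₁₃∣<k = ℕₚ.≤-reflexive (≡.cong (3 ℕ.+_) ∣T∣≡k′)

    mk⊆U : ∀ {b₀ b₁ b₂ b₃ b₄ b₅} → mk b₀ b₁ b₂ b₃ b₄ b₅ ⊆ U
    mk⊆U ∈₀         = ∈₀
    mk⊆U ∈₁         = ∈₁
    mk⊆U ∈₂         = ∈₂
    mk⊆U ∈₃         = ∈₃
    mk⊆U ∈₄         = ∈₄
    mk⊆U ∈₅         = ∈₅
    mk⊆U (∈₆₊ v∈T) = ∈₆₊ v∈T

    ⊆mk : ∀ {K b₀ b₁ b₂ b₃ b₄ b₅} → K ⊆ U →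
          (0F ∈ K → b₀ ≡ true) → (1F ∈ K → b₁ ≡ true) → (2F ∈ K → b₂ ≡ true) →
          (3F ∈ K → b₃ ≡ true) → (4F ∈ K → b₄ ≡ true) → (5F ∈ K → b₅ ≡ true) →
          K ⊆ mk b₀ b₁ b₂ b₃ b₄ b₅
    ⊆mk {K} K⊆U h₀ h₁ h₂ h₃ h₄ h₅ u∈K = go (K⊆U u∈K) u∈K
      where
      go : ∀ {u} → u ∈ U → u ∈ K → u ∈ mk _ _ _ _ _ _
      go ∈₀ 0∈K = here⁺ (h₀ 0∈K)
      go ∈₁ 1∈K = there (here⁺ (h₁ 1∈K))
      go ∈₂ 2∈K = there (there (here⁺ (h₂ 2∈K)))
      go ∈₃ 3∈K = there (there (there (here⁺ (h₃ 3∈K))))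
      go ∈₄ 4∈K = there (there (there (there (here⁺ (h₄ 4∈K)))))
      go ∈₅ 5∈K = there (there (there (there (there (here⁺ (h₅ 5∈K))))))
      go (∈₆₊ v∈T) _ = ∈₆₊ v∈T

    ⊆K₁ : ∀ {K} → K ⊆ U → 0F ∉ K → 1F ∉ K → K ⊆ K₁
    ⊆K₁ K⊆U 0∉K 1∉K = ⊆mk K⊆U (⊥-elim ∘ 0∉K) (⊥-elim ∘ 1∉K) (const ≡.refl) (const ≡.refl) (const ≡.refl) (const ≡.refl)

    ⊆K₂ : ∀ {K} → K ⊆ U → 2F ∉ K → 3F ∉ K → K ⊆ K₂
    ⊆K₂ K⊆U 2∉K 3∉K = ⊆mk K⊆U (const ≡.refl) (const ≡.refl) (⊥-elim ∘ 2∉K) (⊥-elim ∘ 3∉K) (const ≡.refl) (const ≡.refl)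

    ⊆K₃ : ∀ {K} → K ⊆ U → 4F ∉ K → 5F ∉ K → K ⊆ K₃
    ⊆K₃ K⊆U 4∉K 5∉K = ⊆mk K⊆U (const ≡.refl) (const ≡.refl) (const ≡.refl) (const ≡.refl) (⊥-elim ∘ 4∉K) (⊥-elim ∘ 5∉K)

    I₂₃⊆K₂ : I₂₃ ⊆ K₂
    I₂₃⊆K₂ ∈₀         = ∈₀
    I₂₃⊆K₂ ∈₁         = ∈₁
    I₂₃⊆K₂ (∈₆₊ v∈T) = ∈₆₊ v∈T

    I₂₃⊆K₃ : I₂₃ ⊆ K₃
    I₂₃⊆K₃ ∈₀         = ∈₀
    I₂₃⊆K₃ ∈₁         = ∈₁
    I₂₃⊆K₃ (∈₆₊ v∈T) = ∈₆₊ v∈T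

    t₀+t₁≈14 : t 0F + t 1F ≈ ℕ→F 14
    t₀+t₁≈14 = sym (ℕ→F-+ 4 10)

    t₂+t₃≈14 : t 2F + t 3F ≈ ℕ→F 14
    t₂+t₃≈14 = sym (ℕ→F-+ 6 8)

    t₄+t₅≈14 : t 4F + t 5F ≈ ℕ→F 14
    t₄+t₅≈14 = sym (ℕ→F-+ 5 9)

    t₀≉t₁ : t 0F ≉ t 1F
    t₀≉t₁ t₀≈t₁ with t-inj {0F} {1F} t₀≈t₁
    ... | ()

    q : Fin n → Fin n → Carrier → Carrier
    q a b x = (x − t a) * (x − t b)

    q-symmetric : ∀ a b z w → t a + t b ≈ ℕ→F 14 → t z + t w ≈ ℕ→F 14 → q a b (t z) ≈ q a b (t w)
    q-symmetric _ _ _ _ a+b≈14 z+w≈14 = a+b≈z+w⇒[z−a][z−b]≈[w−a][w−b] (trans a+b≈14 (sym z+w≈14))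

    g : Fin n → Carrier
    g u = nodal K₁ t (t u)

    g≉0 : ∀ {u} → u ∉ K₁ → g u ≉ 0#
    g≉0 = nodal-≉0-outside K₁

    g∈D₂ : D α K₂ g
    g∈D₂ = multiple-of-nodal∈D K₂ I₁₂ γ ∣I₁₂∣<k λ where
        _ ∈₀         → g≈γN 0F refl
        _ ∈₁         → g≈γN 1F (q-symmetric 2F 3F 1F 0F t₂+t₃≈14 (trans (+-comm _ _) t₀+t₁≈14))
        _ ∈₄         → both-vanish ∈₄ ∈₄
        _ ∈₅         → both-vanish ∈₅ ∈₅
        _ (∈₆₊ v∈T) → both-vanish (∈₆₊ v∈T) (∈₆₊ v∈T)
      where
      γ : Carrier
      γ = q 2F 3F (t 0F)
      g≈γN : ∀ u → q 2F 3F (t u) ≈ γ → g u ≈ γ * nodal I₁₂ t (t u)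
      g≈γN u qᵤ≈γ = trans (sym (*-assoc _ _ _)) (*-congʳ qᵤ≈γ)
      both-vanish : ∀ {u} → u ∈ K₁ → u ∈ I₁₂ → g u ≈ γ * nodal I₁₂ t (t u)
      both-vanish u∈K₁ u∈I₁₂ = trans (nodal-root K₁ t u∈K₁) (sym (x≈0⇒y*x≈0 γ (nodal-root I₁₂ t u∈I₁₂)))

    g∈D₃ : D α K₃ g
    g∈D₃ = multiple-of-nodal∈D K₃ I₁₃ γ ∣I₁₃∣<k λ where
        _ ∈₀         → g≈γN 0F refl
        _ ∈₁         → g≈γN 1F (q-symmetric 4F 5F 1F 0F t₄+t₅≈14 (trans (+-comm _ _) t₀+t₁≈14))
        _ ∈₂         → both-vanish ∈₂ ∈₂
        _ ∈₃         → both-vanish ∈₃ ∈₃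
        _ (∈₆₊ v∈T) → both-vanish (∈₆₊ v∈T) (∈₆₊ v∈T)
      where
      γ : Carrier
      γ = q 4F 5F (t 0F)
      g≈γN : ∀ u → q 4F 5F (t u) ≈ γ → g u ≈ γ * nodal I₁₃ t (t u)
      g≈γN u qᵤ≈γ = trans (regroup _ _ _ _ _) (*-congʳ qᵤ≈γ)
        where
        regroup : ∀ a b c d P → a * (b * (c * (d * P))) ≈ (c * d) * (a * (b * P))
        regroup = solve 5 (λ a b c d P → a :* (b :* (c :* (d :* P))) := (c :* d) :* (a :* (b :* P))) refl
      both-vanish : ∀ {u} → u ∈ K₁ → u ∈ I₁₃ → g u ≈ γ * nodal I₁₃ t (t u)
      both-vanish u∈K₁ u∈I₁₃ = trans (nodal-root K₁ t u∈K₁) (sym (x≈0⇒y*x≈0 γ (nodal-root I₁₃ t u∈I₁₃)))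

    X : (Fin n → Carrier) → Set (c ⊔ ℓ)
    X x = D α K₂ x × D α K₃ x

    P : Carrier → Carrier
    P = nodal T (λ v → t (6+ v))

    N₂₃-N₁₂-cross : nodal I₂₃ t (t 2F) * nodal I₁₂ t (t 3F) ≈ nodal I₂₃ t (t 3F) * nodal I₁₂ t (t 2F)
    N₂₃-N₁₂-cross = begin
      nodal I₂₃ t (t 2F) * nodal I₁₂ t (t 3F)               ≈⟨ regroup _ _ _ _ _ _ ⟩
      (q 0F 1F (t 2F) * q 4F 5F (t 3F)) * (P (t 2F) * P (t 3F)) ≈⟨ *-cong (*-cong q₀₁ q₄₅) (*-comm _ _) ⟩
      (q 0F 1F (t 3F) * q 4F 5F (t 2F)) * (P (t 3F) * P (t 2F)) ≈⟨ regroup _ _ _ _ _ _ ⟨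
      nodal I₂₃ t (t 3F) * nodal I₁₂ t (t 2F)               ∎
      where
      regroup : ∀ a b P c d Q → (a * (b * P)) * (c * (d * Q)) ≈ ((a * b) * (c * d)) * (P * Q)
      regroup = solve 6 (λ a b P c d Q → (a :* (b :* P)) :* (c :* (d :* Q)) := ((a :* b) :* (c :* d)) :* (P :* Q)) refl
      q₀₁ : q 0F 1F (t 2F) ≈ q 0F 1F (t 3F)
      q₀₁ = q-symmetric 0F 1F 2F 3F t₀+t₁≈14 t₂+t₃≈14
      q₄₅ : q 4F 5F (t 3F) ≈ q 4F 5F (t 2F)
      q₄₅ = q-symmetric 4F 5F 3F 2F t₄+t₅≈14 (trans (+-comm _ _) t₂+t₃≈14)

    module FromK₂K₃ {x : Fin n → Carrier} (y₂ y₃ : Fin k → Carrier)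
                    (y₂≈x : ∀ u → u ∈ K₂ → α u · y₂ ≈ x u) (y₃≈x : ∀ u → u ∈ K₃ → α u · y₃ ≈ x u) where

      d : Fin k → Carrier
      d j = y₃ j − y₂ j

      d-vanishes : ∀ u → u ∈ I₂₃ → eval d (t u) ≈ 0#
      d-vanishes u u∈I₂₃ = trans (eval-− y₃ y₂ (t u))
        (x≈y⇒x−y≈0 (trans (eval≈x y₃ y₃≈x (I₂₃⊆K₃ u∈I₂₃)) (sym (eval≈x y₂ y₂≈x (I₂₃⊆K₂ u∈I₂₃)))))

      d-multiple : ∃ λ δ → ∀ z → eval d z ≈ δ * nodal I₂₃ t z
      d-multiple = vanishing⇒multiple-of-nodal I₂₃ {2F} (λ { (there (there ())) }) ∣I₂₃∣ d d-vanishes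

      δ : Carrier
      δ = proj₁ d-multiple

      N₁₂[2]≉0 : nodal I₁₂ t (t 2F) ≉ 0#
      N₁₂[2]≉0 = nodal-≉0-outside I₁₂ {2F} (λ { (there (there ())) })

      γ : Carrier
      γ = δ * nodal I₂₃ t (t 2F) * inv (nodal I₁₂ t (t 2F)) N₁₂[2]≉0

      y₁ : Fin k → Carrier
      y₁ j = y₂ j + γ * nodalCoeffs k I₁₂ t j

      eval-y₁ : ∀ z → eval y₁ z ≈ eval y₂ z + γ * nodal I₁₂ t z
      eval-y₁ z = trans (eval-+ y₂ (λ j → γ * nodalCoeffs k I₁₂ t j) z) (+-congˡ (trans (eval-* γ (nodalCoeffs k I₁₂ t) z)
                                                        (*-congˡ (eval-nodalCoeffs k I₁₂ t ∣I₁₂∣<k z))))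

      γN≈d : ∀ u → nodal I₂₃ t (t 2F) * nodal I₁₂ t (t u) ≈ nodal I₂₃ t (t u) * nodal I₁₂ t (t 2F) →
             γ * nodal I₁₂ t (t u) ≈ eval d (t u)
      γN≈d u cross = trans (a*b*c⁻¹*d≈a*e δ N₁₂[2]≉0 cross) (sym (proj₂ d-multiple (t u)))

      y₁≈x-on-I₁₂ : ∀ {u} → u ∈ I₁₂ → u ∈ K₂ → α u · y₁ ≈ x u
      y₁≈x-on-I₁₂ {u} u∈I₁₂ u∈K₂ = begin
        α u · y₁                              ≈⟨ α·y≈eval u y₁ ⟩
        eval y₁ (t u)                         ≈⟨ eval-y₁ (t u) ⟩
        eval y₂ (t u) + γ * nodal I₁₂ t (t u) ≈⟨ +-congˡ (x≈0⇒y*x≈0 γ (nodal-root I₁₂ t u∈I₁₂)) ⟩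
        eval y₂ (t u) + 0#                    ≈⟨ +-identityʳ _ ⟩
        eval y₂ (t u)                         ≈⟨ eval≈x y₂ y₂≈x u∈K₂ ⟩
        x u                                   ∎

      y₁≈x-via-K₃ : ∀ {u} → γ * nodal I₁₂ t (t u) ≈ eval d (t u) → u ∈ K₃ → α u · y₁ ≈ x u
      y₁≈x-via-K₃ {u} γN≈dᵤ u∈K₃ = begin
        α u · y₁                                        ≈⟨ α·y≈eval u y₁ ⟩
        eval y₁ (t u)                                   ≈⟨ eval-y₁ (t u) ⟩
        eval y₂ (t u) + γ * nodal I₁₂ t (t u)           ≈⟨ +-congˡ (trans γN≈dᵤ (eval-− y₃ y₂ (t u))) ⟩
        eval y₂ (t u) + (eval y₃ (t u) − eval y₂ (t u)) ≈⟨ b+[a−b]≈a _ _ ⟩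
        eval y₃ (t u)                                   ≈⟨ eval≈x y₃ y₃≈x u∈K₃ ⟩
        x u                                             ∎
        where
        b+[a−b]≈a : ∀ b a → b + (a − b) ≈ a
        b+[a−b]≈a = solve 2 (λ b a → b :+ (a :- b) := a) refl

      y₁≈x : ∀ u → u ∈ K₁ → α u · y₁ ≈ x u
      y₁≈x _ ∈₂         = y₁≈x-via-K₃ (γN≈d 2F refl) ∈₂
      y₁≈x _ ∈₃         = y₁≈x-via-K₃ (γN≈d 3F N₂₃-N₁₂-cross) ∈₃
      y₁≈x _ ∈₄         = y₁≈x-on-I₁₂ ∈₄ ∈₄
      y₁≈x _ ∈₅         = y₁≈x-on-I₁₂ ∈₅ ∈₅
      y₁≈x _ (∈₆₊ v∈T) = y₁≈x-on-I₁₂ (∈₆₊ v∈T) (∈₆₊ v∈T)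

    X⊆D₁ : X ⊆ₚ D α K₁
    X⊆D₁ x ((y₂ , y₂≈x) , (y₃ , y₃≈x)) = y₁ , y₁≈x
      where open FromK₂K₃ y₂ y₃ y₂≈x y₃≈x

    node≥5 : ∀ {p} → p ∈ K₁ → 5 ℕ.≤ node p
    node≥5 ∈₂ = ℕₚ.≤ᵇ⇒≤ 5 6 _
    node≥5 ∈₃ = ℕₚ.≤ᵇ⇒≤ 5 8 _
    node≥5 ∈₄ = ℕₚ.≤-refl
    node≥5 ∈₅ = ℕₚ.≤ᵇ⇒≤ 5 9 _
    node≥5 {6+ v} (∈₆₊ _) = ℕₚ.≤-trans (ℕₚ.≤ᵇ⇒≤ 5 11 _) (ℕₚ.m≤m+n 11 (toℕ v))

    11+m+x≢14 : ∀ m {x} → 5 ℕ.≤ x → 11 ℕ.+ m ℕ.+ x ≢ 14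
    11+m+x≢14 m x≥5 e = ℕₚ.<⇒≱ (ℕₚ.≤ᵇ⇒≤ 15 16 _)
      (≡.subst (16 ℕ.≤_) e (ℕₚ.+-mono-≤ (ℕₚ.m≤m+n 11 m) x≥5))

    sum-14-pairs : ∀ {p q} → p ∈ K₁ → q ∈ K₁ → p ≢ q → node p ℕ.+ node q ≡ 14 →
                   (p ≡ 2F × q ≡ 3F) ⊎ (p ≡ 3F × q ≡ 2F) ⊎ (p ≡ 4F × q ≡ 5F) ⊎ (p ≡ 5F × q ≡ 4F)
    sum-14-pairs {6+ v} (∈₆₊ _) q∈K₁ _ e = ⊥-elim (11+m+x≢14 (toℕ v) (node≥5 q∈K₁) e)
    sum-14-pairs {p} {6+ v} p∈K₁ (∈₆₊ _) _ e = ⊥-elim (11+m+x≢14 (toℕ v) (node≥5 p∈K₁) (≡.trans (ℕₚ.+-comm (node (6+ v)) (node p)) e))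
    sum-14-pairs ∈₂ ∈₃ _ _ = inj₁ (≡.refl , ≡.refl)
    sum-14-pairs ∈₃ ∈₂ _ _ = inj₂ (inj₁ (≡.refl , ≡.refl))
    sum-14-pairs ∈₄ ∈₅ _ _ = inj₂ (inj₂ (inj₁ (≡.refl , ≡.refl)))
    sum-14-pairs ∈₅ ∈₄ _ _ = inj₂ (inj₂ (inj₂ (≡.refl , ≡.refl)))
    sum-14-pairs ∈₂ ∈₂ p≢q _ = ⊥-elim (p≢q ≡.refl)
    sum-14-pairs ∈₃ ∈₃ p≢q _ = ⊥-elim (p≢q ≡.refl)
    sum-14-pairs ∈₄ ∈₄ p≢q _ = ⊥-elim (p≢q ≡.refl)
    sum-14-pairs ∈₅ ∈₅ p≢q _ = ⊥-elim (p≢q ≡.refl)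
    sum-14-pairs ∈₂ ∈₄ _ ()
    sum-14-pairs ∈₂ ∈₅ _ ()
    sum-14-pairs ∈₃ ∈₄ _ ()
    sum-14-pairs ∈₃ ∈₅ _ ()
    sum-14-pairs ∈₄ ∈₂ _ ()
    sum-14-pairs ∈₄ ∈₃ _ ()
    sum-14-pairs ∈₅ ∈₂ _ ()
    sum-14-pairs ∈₅ ∈₃ _ ()

    module Classification {K : Subset n} (∣K∣≡k+1 : IsIndex k K) (X⊆D : X ⊆ₚ D α K) where

      K⊆U : K ⊆ U
      K⊆U {m} m∈K with m Subsetₚ.∈? U
      ... | yes m∈U = m∈U
      ... | no  m∉U = ⊥-elim (𝟙⁅m⁆∉D ∣K∣≡k+1 m∈K (X⊆D _ (𝟙⁅m⁆∈D (m∉U ∘ mk⊆U) , 𝟙⁅m⁆∈D (m∉U ∘ mk⊆U))))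

      g∈D : D α K g
      g∈D = X⊆D g (g∈D₂ , g∈D₃)

      K-a⊄K₁ : ∀ {a} → a ∈ K → a ∉ K₁ → ¬ (K - a ⊆ K₁)
      K-a⊄K₁ a∈K a∉K₁ K-a⊆K₁ =
        g≉0 a∉K₁ (D∧vanishing⇒≈0 ∣K∣≡k+1 a∈K g∈D (λ u u∈K-a → nodal-root K₁ t (K-a⊆K₁ u∈K-a)))

      K-a⊆U : ∀ a → K - a ⊆ U
      K-a⊆U a = K⊆U ∘ x∈p-y⇒x∈p K a

      a∉K-a : ∀ a → a ∉ K - a
      a∉K-a a a∈K-a = x∈p-y⇒x≢y K a a∈K-a ≡.refl

      0∈K⇒1∈K : 0F ∈ K → 1F ∈ K
      0∈K⇒1∈K 0∈K with 1F Subsetₚ.∈? K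
      ... | yes 1∈K = 1∈K
      ... | no  1∉K = ⊥-elim (K-a⊄K₁ 0∈K (λ ()) (⊆K₁ (K-a⊆U 0F) (a∉K-a 0F) (1∉K ∘ x∈p-y⇒x∈p K 0F)))

      1∈K⇒0∈K : 1F ∈ K → 0F ∈ K
      1∈K⇒0∈K 1∈K with 0F Subsetₚ.∈? K
      ... | yes 0∈K = 0∈K
      ... | no  0∉K = ⊥-elim (K-a⊄K₁ 1∈K (λ { (there ()) }) (⊆K₁ (K-a⊆U 1F) (0∉K ∘ x∈p-y⇒x∈p K 1F) (a∉K-a 1F)))

      ∣K∣≤ : ∀ (K′ : Subset n) → IsIndex k K′ → ∣ K′ ∣ ℕ.≤ ∣ K ∣
      ∣K∣≤ _ ∣K′∣≡k+1 = ℕₚ.≤-reflexive (≡.trans ∣K′∣≡k+1 (≡.sym ∣K∣≡k+1))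

      0∉K⇒K≡K₁ : 0F ∉ K → K ≡ K₁
      0∉K⇒K≡K₁ 0∉K = p⊆q∧∣q∣≤∣p∣⇒p≡q (⊆K₁ K⊆U 0∉K (0∉K ∘ 1∈K⇒0∈K)) (∣K∣≤ K₁ ∣K₁∣)

      K≡K₂ : 2F ∉ K → 3F ∉ K → K ≡ K₂
      K≡K₂ 2∉K 3∉K = p⊆q∧∣q∣≤∣p∣⇒p≡q (⊆K₂ K⊆U 2∉K 3∉K) (∣K∣≤ K₂ ∣K₂∣)

      K≡K₃ : 4F ∉ K → 5F ∉ K → K ≡ K₃
      K≡K₃ 4∉K 5∉K = p⊆q∧∣q∣≤∣p∣⇒p≡q (⊆K₃ K⊆U 4∉K 5∉K) (∣K∣≤ K₃ ∣K₃∣)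

      module Contains0 (0∈K : 0F ∈ K) (y : Fin k → Carrier) (y≈g : ∀ u → u ∈ K → α u · y ≈ g u) where

        1∈K : 1F ∈ K
        1∈K = 0∈K⇒1∈K 0∈K

        0∉K₁ : 0F ∉ K₁
        0∉K₁ ()

        1∉K₁ : 1F ∉ K₁
        1∉K₁ (there ())

        A P′ : Subset n
        A  = K₁ ∩ K
        P′ = K₁ ─ K

        K-0-1⊆K₁ : K - 0F - 1F ⊆ K₁
        K-0-1⊆K₁ = ⊆K₁ (K-a⊆U 0F ∘ x∈p-y⇒x∈p (K - 0F) 1F) (a∉K-a 0F ∘ x∈p-y⇒x∈p (K - 0F) 1F)
                       (λ 1∈K-0-1 → x∈p-y⇒x≢y (K - 0F) 1F 1∈K-0-1 ≡.refl)

        A≡K-0-1 : A ≡ K - 0F - 1F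
        A≡K-0-1 = Subsetₚ.⊆-antisym A⊆K-0-1 λ u∈K-0-1 →
          Subsetₚ.x∈p∩q⁺ (K-0-1⊆K₁ u∈K-0-1 , x∈p-y⇒x∈p K 0F (x∈p-y⇒x∈p (K - 0F) 1F u∈K-0-1))
          where
          A⊆K-0-1 : A ⊆ K - 0F - 1F
          A⊆K-0-1 u∈A with Subsetₚ.x∈p∩q⁻ K₁ K u∈A
          ... | u∈K₁ , u∈K = Subsetₚ.x∈p∧x≢y⇒x∈p-y {y = 1F} (Subsetₚ.x∈p∧x≢y⇒x∈p-y {y = 0F} u∈K (λ { ≡.refl → 0∉K₁ u∈K₁ }))
                                                   (λ { ≡.refl → 1∉K₁ u∈K₁ })

        ∣A∣ : suc ∣ A ∣ ≡ k
        ∣A∣ = ≡.trans (≡.cong (suc ∘ ∣_∣) A≡K-0-1)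
                (≡.trans (∣p-x∣ (K - 0F) (Subsetₚ.x∈p∧x≢y⇒x∈p-y {y = 0F} 1∈K (λ ()))) (∣p-x∣≡m K 0∈K ∣K∣≡k+1))

        ∣P′∣ : ∣ P′ ∣ ≡ 2
        ∣P′∣ = ℕₚ.+-cancelˡ-≡ ∣ A ∣ _ _ (≡.trans (≡.sym (∣p∣≡∣p∩q∣+∣p─q∣ K₁ K))
                 (≡.trans ∣K₁∣ (≡.trans (≡.cong suc (≡.sym ∣A∣)) (ℕₚ.+-comm 2 ∣ A ∣))))

        y-vanishes : ∀ u → u ∈ A → eval y (t u) ≈ 0#
        y-vanishes u u∈A = trans (eval≈x y y≈g (proj₂ (Subsetₚ.x∈p∩q⁻ K₁ K u∈A)))
                                 (nodal-root K₁ t (proj₁ (Subsetₚ.x∈p∩q⁻ K₁ K u∈A)))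

        y-multiple : ∃ λ γ → ∀ z → eval y z ≈ γ * nodal A t z
        y-multiple = vanishing⇒multiple-of-nodal A {0F} (0∉K₁ ∘ proj₁ ∘ Subsetₚ.x∈p∩q⁻ K₁ K) ∣A∣ y y-vanishes

        nodal-P′-constant : ∀ {u} → u ∈ K → u ∉ K₁ → nodal P′ t (t u) ≈ proj₁ y-multiple
        nodal-P′-constant {u} u∈K u∉K₁ = *-cancelˡ (nodal-≉0-outside A (u∉K₁ ∘ proj₁ ∘ Subsetₚ.x∈p∩q⁻ K₁ K)) (begin
          nodal A t (t u) * nodal P′ t (t u) ≈⟨ nodal-∩─ K₁ K t (t u) ⟨
          g u                                ≈⟨ eval≈x y y≈g u∈K ⟨
          eval y (t u)                       ≈⟨ proj₂ y-multiple (t u) ⟩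
          proj₁ y-multiple * nodal A t (t u) ≈⟨ *-comm _ _ ⟩
          nodal A t (t u) * proj₁ y-multiple ∎)

        excluded-pair : ∃₂ λ p q → p ∈ K₁ × q ∈ K₁ × p ≢ q × p ∉ K × q ∉ K × node p ℕ.+ node q ≡ 14
        excluded-pair = from-factors (nodal-pair P′ t ∣P′∣)
          where
          from-factors : (∃₂ λ p q → p ∈ P′ × q ∈ P′ × p ≢ q × (∀ x → nodal P′ t x ≈ (x − t p) * (x − t q))) →
                         ∃₂ λ p q → p ∈ K₁ × q ∈ K₁ × p ≢ q × p ∉ K × q ∉ K × node p ℕ.+ node q ≡ 14
          from-factors (p , q , p∈P′ , q∈P′ , p≢q , P′≈) =
            p , q , Subsetₚ.p─q⊆p K₁ K p∈P′ , Subsetₚ.p─q⊆p K₁ K q∈P′ , p≢q ,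
            x∈p─q⇒x∉q K₁ K p∈P′ , x∈p─q⇒x∉q K₁ K q∈P′ , ℕ→F-injective char0 node-sum
            where
            same-values : (t 0F − t p) * (t 0F − t q) ≈ (t 1F − t p) * (t 1F − t q)
            same-values = trans (sym (P′≈ (t 0F)))
              (trans (nodal-P′-constant 0∈K 0∉K₁) (trans (sym (nodal-P′-constant 1∈K 1∉K₁)) (P′≈ (t 1F))))
            node-sum : ℕ→F (node p ℕ.+ node q) ≈ ℕ→F 14
            node-sum = trans (ℕ→F-+ (node p) (node q))
              (trans ([z−a][z−b]≈[w−a][w−b]⇒a+b≈z+w t₀≉t₁ same-values) t₀+t₁≈14)

        K≡K₂⊎K≡K₃ : K ≡ K₂ ⊎ K ≡ K₃
        K≡K₂⊎K≡K₃ = from-pair excluded-pair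
          where
          by-position : ∀ {p q} → (p ≡ 2F × q ≡ 3F) ⊎ (p ≡ 3F × q ≡ 2F) ⊎ (p ≡ 4F × q ≡ 5F) ⊎ (p ≡ 5F × q ≡ 4F) →
                        p ∉ K → q ∉ K → K ≡ K₂ ⊎ K ≡ K₃
          by-position (inj₁ (≡.refl , ≡.refl))                p∉K q∉K = inj₁ (K≡K₂ p∉K q∉K)
          by-position (inj₂ (inj₁ (≡.refl , ≡.refl)))         p∉K q∉K = inj₁ (K≡K₂ q∉K p∉K)
          by-position (inj₂ (inj₂ (inj₁ (≡.refl , ≡.refl)))) p∉K q∉K = inj₂ (K≡K₃ p∉K q∉K)
          by-position (inj₂ (inj₂ (inj₂ (≡.refl , ≡.refl)))) p∉K q∉K = inj₂ (K≡K₃ q∉K p∉K)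
          from-pair : (∃₂ λ p q → p ∈ K₁ × q ∈ K₁ × p ≢ q × p ∉ K × q ∉ K × node p ℕ.+ node q ≡ 14) → K ≡ K₂ ⊎ K ≡ K₃
          from-pair (p , q , p∈K₁ , q∈K₁ , p≢q , p∉K , q∉K , sum) = by-position (sum-14-pairs p∈K₁ q∈K₁ p≢q sum) p∉K q∉K

      classify : K ≡ K₁ ⊎ K ≡ K₂ ⊎ K ≡ K₃
      classify with 0F Subsetₚ.∈? K
      ... | no  0∉K = inj₁ (0∉K⇒K≡K₁ 0∉K)
      ... | yes 0∈K = inj₂ (Contains0.K≡K₂⊎K≡K₃ 0∈K (proj₁ g∈D) (proj₂ g∈D))

    ≡⇒≐ : ∀ {K K′} → K ≡ K′ → D α K ≐ D α K′
    ≡⇒≐ ≡.refl = (λ _ x∈D → x∈D) , (λ _ x∈D → x∈D)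

    X-codim2 : IsCodim2Subspace X
    X-codim2 = D∩D-codim2 ∣K₂∣ ∣K₃∣ ∈₄ (λ { (there (there (there (there ())))) }) ∈₂ (λ { (there (there ())) })

    X-intersection : IsIntersectionOfD α X
    X-intersection = K₂ ∷ K₃ ∷ [] , ∣K₂∣ ∷ ∣K₃∣ ∷ [] ,
                     (λ _ (x∈D₂ , x∈D₃) → x∈D₂ ∷ x∈D₃ ∷ []) , (λ { _ (x∈D₂ ∷ x∈D₃ ∷ []) → x∈D₂ , x∈D₃ })

    X-multiplicity-3 : ContainedInExactly3 α X
    X-multiplicity-3 =
      K₁ , K₂ , K₃ , ∣K₁∣ , ∣K₂∣ , ∣K₃∣ , X⊆D₁ , (λ _ → proj₁) , (λ _ → proj₂) ,
      D-distinct ∣K₂∣ (λ ()) ∈₀ , D-distinct ∣K₃∣ (λ ()) ∈₀ , D-distinct ∣K₃∣ (λ { (there (there ())) }) ∈₂ ,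
      λ K ∣K∣≡k+1 X⊆D → Sum.map ≡⇒≐ (Sum.map ≡⇒≐ ≡⇒≐) (Classification.classify ∣K∣≡k+1 X⊆D)

    -- The constants cᵢ do not enter the discriminantal arrangement, so any choice works.
    generic-with-triple-stratum : ∃ λ (α′ : Fin n → Fin k → Carrier) → ∃ λ (cs : Fin n → Carrier) →
                                    IsGeneric α′ × HasCodim2StratumMult3 α′
    generic-with-triple-stratum = α , (λ _ → 0#) , momentCurve-generic , X , X-codim2 , X-intersection , X-multiplicity-3

open import Data.Nat using (_≤_; _+_)

corollary3p5 : ∀ {c ℓ : Level} (F : Field c ℓ) →
    FieldNotions.HasCharZero F → FieldNotions.IsAlgClosed F →
    ∀ (k n : ℕ) → 3 ≤ k → k + 3 ≤ n →
    ∃ λ (α : Fin n → Fin k → Field.Carrier F) → ∃ λ (cs : Fin n → Field.Carrier F) →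
      FieldNotions.IsGeneric F α × FieldNotions.HasCodim2StratumMult3 F α
corollary3p5 F char0 _ k@(suc (suc (suc k′))) n (s≤s (s≤s (s≤s z≤n))) k+3≤n
  with ℕₚ.m≤n⇒∃[o]m+o≡n k+3≤n
... | r , k+3+r≡n = ≡.subst (λ n → ∃ λ (α : Fin n → Fin k → Field.Carrier F) → ∃ λ (cs : Fin n → Field.Carrier F) →
                                      FieldNotions.IsGeneric F α × FieldNotions.HasCodim2StratumMult3 F α)
                           (≡.trans (≡.cong (λ m → 3 + (m + r)) (ℕₚ.+-comm 3 k′)) k+3+r≡n)
                           (Construction.generic-with-triple-stratum F char0 k′ r)
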